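{- Let $L \in \mathbb{N}$, $S = 1$, and let $\beta>0$ satisfy $L\beta + \beta^2 = 1$. Let $(\xi_m)_{m\geq 1}$ be the $LS$-sequence of points (defined in the context). Define integers $q_{ -1}=1$, $q_0=0$, $q_i = Lq_{i-1}+q_{i-2}$ for $i\ge1$. Split the sequence into consecutive blocks: $B_1 = (\xi_1)$, and for $n\ge 2$ the block $B_n$ consists of the next $L q_{n-1}$ consecutive terms after $B_{n-1}$. Then for every $n\in\mathbb{N}$ the following hold. (i) If $n = 2k+1$ is odd, then $B_n$, regarded as a set, consists of the $L q_{2k}$ elements $\{ -q_{2k-1}\beta\}, \{ -(q_{2k-1}+1)\beta\}, \dots, \{ -(q_{2k+1}-1)\beta\}$. In the case $n = 1$, it consists of the single element $0$. (ii) If $n = 2k$ is even, then $B_n$, regarded as a set, consists of the $L q_{2k-1}$ elements $\{(q_{2k-2}+1)\beta\}, \{(q_{2k-2}+2)\beta\}, \dots, \{q_{2k}\beta\}$.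
   Context: $\{z\} = z - \lfloor z \rfloor$ denotes the fractional part. $LS$-sequence for $S=1$. Let $l_0 = 1$, $l_1 = L$, and $l_n = Ll_{n-1}+l_{n-2}$ for $n \geq 2$. Let $t_0 = 1$, $t_1 = L+1$, and $t_n = Lt_{n-1}+t_{n-2}$ for $n \geq 2$. Put $\psi^{(n)}_{i,0}(x) = x + i\beta^n$. Let $\Lambda^1 = (0, \beta, 2\beta, \dots, L\beta)$; these are the left endpoints, ordered by magnitude, of the partition of $[0,1)$ into $L$ intervals of length $\beta$ followed by one interval of length $\beta^2$. Given $\Lambda^n = (\xi_1, \dots, \xi_{t_n})$, let $\Lambda^{n+1}$ be the list $\xi_1, \dots, \xi_{t_n}, \ \psi^{(n+1)}_{1,0}(\xi_1), \dots, \psi^{(n+1)}_{1,0}(\xi_{l_n}), \ \dots,\ \psi^{(n+1)}_{L,0}(\xi_1), \dots, \psi^{(n+1)}_{L,0}(\xi_{l_n})$. Each $\Lambda^n$ is an initial segment of $\Lambda^{n+1}$. The $LS$-sequence $(\xi_m)_{m\ge1}$ is the infinite sequence having all $\Lambda^n$ as initial segments. -}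

module Defs where

open import Data.Nat as ℕ using (ℕ; zero; suc; _∸_)
open import Data.Integer as ℤ using (ℤ; +_; -_; _-_)
open import Data.Product using (_×_; _,_; Σ; ∃)
open import Data.Sum using (_⊎_)
open import Data.List using (List; []; _∷_; _++_; map; concat; take; upTo)
open import Relation.Binary.PropositionalEquality using (_≡_)

-- The parameter L (≥ 1) is passed explicitly everywhere.
-- β > 0 with Lβ + β² = 1 is β = (√(L²+4) − L)/2, irrational for L ≥ 1.
-- All points of the LS-sequence lie in ℤ[β] = ℤ + ℤβ ⊂ ℝ, so we work
-- exactly in that ordered ring: the pair (a , b) denotes the real a + bβ.
-- (The representation is unique since β is irrational.)

Zβ : Set
Zβ = ℤ × ℤ

zeroβ : Zβ
zeroβ = (+ 0 , + 0)

oneβ : Zβ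
oneβ = (+ 1 , + 0)

intβ : ℤ → Zβ
intβ c = (c , + 0)

βelt : Zβ
βelt = (+ 0 , + 1)

_⊕_ : Zβ → Zβ → Zβ
(a , b) ⊕ (c , d) = (a ℤ.+ c , b ℤ.+ d)

⊖_ : Zβ → Zβ
⊖ (a , b) = (- a , - b)

_⊝_ : Zβ → Zβ → Zβ
x ⊝ y = x ⊕ (⊖ y)

-- multiplication uses β² = 1 − Lβ
mulβ : ℕ → Zβ → Zβ → Zβ
mulβ L (a , b) (c , d) =
  (a ℤ.* c ℤ.+ b ℤ.* d , a ℤ.* d ℤ.+ b ℤ.* c - (+ L) ℤ.* (b ℤ.* d))

βpow : ℕ → ℕ → Zβ
βpow L zero    = oneβ
βpow L (suc n) = mulβ L βelt (βpow L n)

scal : ℤ → Zβ → Zβ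
scal c (a , b) = (c ℤ.* a , c ℤ.* b)

-- Order: 2(a + bβ) = u + v√D with u = 2a − bL, v = b, D = L² + 4.
-- Pos L x  means  a + bβ > 0  as a real number.
Pos : ℕ → Zβ → Set
Pos L (a , b) =
    ((+ 0 ℤ.< u) × (+ 0 ℤ.≤ v))
  ⊎ ((+ 0 ℤ.≤ u) × (+ 0 ℤ.< v))
  ⊎ ((+ 0 ℤ.< u) × (v ℤ.< + 0) × (v ℤ.* v ℤ.* D ℤ.< u ℤ.* u))
  ⊎ ((u ℤ.< + 0) × (+ 0 ℤ.< v) × (u ℤ.* u ℤ.< v ℤ.* v ℤ.* D))
  where
    u = (+ 2) ℤ.* a - b ℤ.* (+ L)
    v = b
    D = + (L ℕ.* L ℕ.+ 4)

_≤[_]_ : Zβ → ℕ → Zβ → Set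
x ≤[ L ] y = (x ≡ y) ⊎ Pos L (y ⊝ x)

_<[_]_ : Zβ → ℕ → Zβ → Set
x <[ L ] y = Pos L (y ⊝ x)

IsFrac : ℕ → Zβ → Zβ → Set
IsFrac L z y = Σ ℤ (λ c → y ≡ z ⊕ intβ c) × (zeroβ ≤[ L ] y) × (y <[ L ] oneβ)

lseq : ℕ → ℕ → ℕ
lseq L zero = 1
lseq L (suc zero) = L
lseq L (suc (suc n)) = L ℕ.* lseq L (suc n) ℕ.+ lseq L n

tseq : ℕ → ℕ → ℕ
tseq L zero = 1
tseq L (suc zero) = L ℕ.+ 1
tseq L (suc (suc n)) = L ℕ.* tseq L (suc n) ℕ.+ tseq L n

ψ : ℕ → ℕ → ℕ → Zβ → Zβ
ψ L n i x = x ⊕ scal (+ i) (βpow L n)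

-- Λ' L n = Λ^{n+1}
Λ' : ℕ → ℕ → List Zβ
Λ' L zero    = map (λ i → scal (+ i) βelt) (upTo (suc L))
Λ' L (suc n) =
  Λ' L n ++ concat (map (λ i → map (ψ L (suc (suc n)) (suc i)) (take (lseq L (suc n)) (Λ' L n)))
                        (upTo L))

-- n-th element (0-based) with a default (never used: Λ' L m has ≥ m+2 entries)
nth : List Zβ → ℕ → Zβ
nth []       _       = zeroβ
nth (x ∷ xs) zero    = x
nth (x ∷ xs) (suc k) = nth xs k

-- ξ_m for m ≥ 1 (ξ_m is the m-th entry of Λ^m, which has t_m ≥ m entries)
ξ : ℕ → ℕ → Zβ
ξ L m = nth (Λ' L m) (m ∸ 1)

-- q_i, shifted: qq L i = q_{i-1}  (so qq 0 = q_{-1} = 1, qq 1 = q_0 = 0)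
qq : ℕ → ℕ → ℕ
qq L zero = 1
qq L (suc zero) = 0
qq L (suc (suc i)) = L ℕ.* qq L (suc i) ℕ.+ qq L i

-- block sizes: |B_1| = 1, |B_n| = L q_{n-1} = L * qq L n  for n ≥ 2
blockSize : ℕ → ℕ → ℕ
blockSize L zero = 0
blockSize L (suc zero) = 1
blockSize L (suc (suc n)) = L ℕ.* qq L (suc (suc n))

-- 1-based index of the first term of B_n (n ≥ 1)
blockStart : ℕ → ℕ → ℕ
blockStart L zero = 1
blockStart L (suc n) = blockStart L n ℕ.+ blockSize L n

block : ℕ → ℕ → List Zβ
block L n = map (λ j → ξ L (blockStart L n ℕ.+ j)) (upTo (blockSize L n))

{-# OPTIONS --safe #-}
module Submission where

-- Points of ℤ[β] are pairs (a , b) standing for a + bβ.  Λ^(n+1) is the set of left endpoints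
-- of a partition of [0,1) into intervals of lengths β^(n+1) and β^(n+2); Λ^(n+2) cuts every
-- long interval [x, x + β^(n+1)) at x + iβ^(n+2), 1 ≤ i ≤ L, since Lβ^(n+2) + β^(n+3) = β^(n+1),
-- and these new points form one block.  The β-coordinates of the long and of the short left
-- endpoints each run through a range of consecutive integers; as the β-coordinate of β^(n+2)
-- is ∓q_(n+2) with alternating sign, the new points fill the range just below (n even) or just
-- above (n odd) the old ones.  A point a + bβ in [0,1) equals {bβ}, which describes the blocks.
-- Order in ℤ[β] is decided without real numbers: a q_k + b q_(k-1) eventually has the sign of
-- a + bβ, and Cassini's identity turns eventual positivity into the criterion Pos of Defs.

open import Data.Nat.Base using (ℕ)
import Data.Nat.Base as ℕ

module ZβArithmetic where

  open import Defs
  open import Data.Nat as ℕ using (ℕ; zero; suc)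
  import Data.Nat.Properties as ℕ
  open import Data.Integer using (+_; -_; _+_; _*_; _-_)
  import Data.Integer.Properties as ℤ
  open import Data.Integer.Tactic.RingSolver using (solve-∀)
  open import Data.Product using (_,_; proj₁; proj₂)
  open import Relation.Binary.PropositionalEquality

  ⊕-assoc : ∀ x y z → (x ⊕ y) ⊕ z ≡ x ⊕ (y ⊕ z)
  ⊕-assoc (a , b) (c , d) (e , f) = cong₂ _,_ (ℤ.+-assoc a c e) (ℤ.+-assoc b d f)

  ⊝≡zeroβ⇒≡ : ∀ x y → x ⊝ y ≡ zeroβ → x ≡ y
  ⊝≡zeroβ⇒≡ (a , b) (c , d) eq = cong₂ _,_ (ℤ.i-j≡0⇒i≡j a c (cong proj₁ eq)) (ℤ.i-j≡0⇒i≡j b d (cong proj₂ eq))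

  scal-identity : ∀ x → scal (+ 1) x ≡ x
  scal-identity (a , b) = cong₂ _,_ (ℤ.*-identityˡ a) (ℤ.*-identityˡ b)

  scal-suc : ∀ n x → scal (+ suc n) x ≡ scal (+ n) x ⊕ x
  scal-suc n (a , b) = cong₂ _,_ (distrib (+ n) a) (distrib (+ n) b)
    where
    distrib : ∀ n a → (+ 1 + n) * a ≡ n * a + a
    distrib = solve-∀

  module _ (L : ℕ) where

    +qq-rec : ∀ i → + qq L (suc (suc i)) ≡ + L * + qq L (suc i) + + qq L i
    +qq-rec i = trans (ℤ.pos-+ (L ℕ.* qq L (suc i)) (qq L i)) (cong (_+ + qq L i) (ℤ.pos-* L (qq L (suc i))))

    mulβ-βelt : ∀ a b → mulβ L βelt (a , b) ≡ (b , a - + L * b)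
    mulβ-βelt a b = cong₂ _,_ (first a b) (second (+ L) a b)
      where
      first : ∀ a b → + 0 * a + + 1 * b ≡ b
      first = solve-∀
      second : ∀ l a b → + 0 * b + + 1 * a - l * (+ 1 * b) ≡ a - l * b
      second = solve-∀

    mulβ-⊕ : ∀ x y → mulβ L βelt (x ⊕ y) ≡ mulβ L βelt x ⊕ mulβ L βelt y
    mulβ-⊕ (a , b) (c , d) = begin
      mulβ L βelt (a + c , b + d)             ≡⟨ mulβ-βelt (a + c) (b + d) ⟩
      (b + d , a + c - + L * (b + d))         ≡⟨ cong (b + d ,_) (distrib (+ L) a b c d) ⟩
      (b , a - + L * b) ⊕ (d , c - + L * d)   ≡⟨ sym (cong₂ _⊕_ (mulβ-βelt a b) (mulβ-βelt c d)) ⟩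
      mulβ L βelt (a , b) ⊕ mulβ L βelt (c , d) ∎
      where
      open ≡-Reasoning
      distrib : ∀ l a b c d → a + c - l * (b + d) ≡ (a - l * b) + (c - l * d)
      distrib = solve-∀

    mulβ-scal : ∀ c x → mulβ L βelt (scal c x) ≡ scal c (mulβ L βelt x)
    mulβ-scal c (a , b) = begin
      mulβ L βelt (c * a , c * b)       ≡⟨ mulβ-βelt (c * a) (c * b) ⟩
      (c * b , c * a - + L * (c * b))   ≡⟨ cong (c * b ,_) (distrib (+ L) c a b) ⟩
      scal c (b , a - + L * b)          ≡⟨ sym (cong (scal c) (mulβ-βelt a b)) ⟩
      scal c (mulβ L βelt (a , b))      ∎
      where
      open ≡-Reasoning
      distrib : ∀ l c a b → c * a - l * (c * b) ≡ c * (a - l * b)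
      distrib = solve-∀

    βpow-one : βpow L 1 ≡ βelt
    βpow-one = cong₂ _,_ refl (lemma (+ L))
      where
      lemma : ∀ l → + 1 - l * + 0 ≡ + 1
      lemma = solve-∀

    βpow-unfold : ∀ n → βpow L n ≡ scal (+ L) (βpow L (suc n)) ⊕ βpow L (suc (suc n))
    βpow-unfold zero = begin
      oneβ                                      ≡⟨ cong₂ _,_ (first (+ L)) (second (+ L)) ⟩
      scal (+ L) βelt ⊕ (+ 1 , + 0 - + L * + 1)  ≡⟨ sym (cong₂ (λ u v → scal (+ L) u ⊕ v) βpow-one βpow-two) ⟩
      scal (+ L) (βpow L 1) ⊕ βpow L 2          ∎
      where
      open ≡-Reasoning
      βpow-two : βpow L 2 ≡ (+ 1 , + 0 - + L * + 1)
      βpow-two = trans (cong (mulβ L βelt) βpow-one) (mulβ-βelt (+ 0) (+ 1))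
      first : ∀ l → + 1 ≡ l * + 0 + + 1
      first = solve-∀
      second : ∀ l → + 0 ≡ l * + 1 + (+ 0 - l * + 1)
      second = solve-∀
    βpow-unfold (suc n) = begin
      mulβ L βelt (βpow L n)                            ≡⟨ cong (mulβ L βelt) (βpow-unfold n) ⟩
      mulβ L βelt (scal (+ L) β₁ ⊕ β₂)                  ≡⟨ mulβ-⊕ (scal (+ L) β₁) β₂ ⟩
      mulβ L βelt (scal (+ L) β₁) ⊕ mulβ L βelt β₂      ≡⟨ cong (_⊕ mulβ L βelt β₂) (mulβ-scal (+ L) β₁) ⟩
      scal (+ L) (mulβ L βelt β₁) ⊕ mulβ L βelt β₂      ∎
      where
      open ≡-Reasoning
      β₁ = βpow L (suc n)
      β₂ = βpow L (suc (suc n))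

    βpow-even : ∀ j → βpow L (j ℕ.+ j) ≡ (+ qq L (j ℕ.+ j) , - + qq L (suc (j ℕ.+ j)))
    βpow-odd  : ∀ j → βpow L (suc (j ℕ.+ j)) ≡ (- + qq L (suc (j ℕ.+ j)) , + qq L (suc (suc (j ℕ.+ j))))

    βpow-even zero = refl
    βpow-even (suc j) rewrite ℕ.+-suc j j =
      trans (cong (mulβ L βelt) (βpow-odd j))
            (trans (mulβ-βelt (- p) p′) (cong (p′ ,_) (trans (lemma (+ L) p p′) (cong -_ (sym (+qq-rec (suc (j ℕ.+ j))))))))
      where
      p = + qq L (suc (j ℕ.+ j))
      p′ = + qq L (suc (suc (j ℕ.+ j)))
      lemma : ∀ l p p′ → - p - l * p′ ≡ - (l * p′ + p)
      lemma = solve-∀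
    βpow-odd j =
      trans (cong (mulβ L βelt) (βpow-even j))
            (trans (mulβ-βelt p (- p′)) (cong (- p′ ,_) (trans (lemma (+ L) p p′) (sym (+qq-rec (j ℕ.+ j))))))
      where
      p = + qq L (j ℕ.+ j)
      p′ = + qq L (suc (j ℕ.+ j))
      lemma : ∀ l p p′ → p - l * (- p′) ≡ l * p′ + p
      lemma = solve-∀

module IntegerSigns where

  open import Data.Nat.Base using (z≤n; s≤s)
  open import Data.Integer
  open import Data.Integer.Properties
  open import Relation.Binary.PropositionalEquality using (refl; subst)
  open import Data.Empty using (⊥-elim)

  pos*pos>0 : ∀ {i j} → + 0 < i → + 0 < j → + 0 < i * j
  pos*pos>0 (+<+ (s≤s _)) (+<+ (s≤s _)) = +<+ (s≤s z≤n)

  nonNeg*nonNeg≥0 : ∀ {i j} → + 0 ≤ i → + 0 ≤ j → + 0 ≤ i * j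
  nonNeg*nonNeg≥0 {+ m} {+ n} _ _ = subst (+ 0 ≤_) (pos-* m n) (+≤+ z≤n)

  neg*pos<0 : ∀ {i j} → i < + 0 → + 0 < j → i * j < + 0
  neg*pos<0 -<+ (+<+ (s≤s _)) = -<+

  neg*neg>0 : ∀ {i j} → i < + 0 → j < + 0 → + 0 < i * j
  neg*neg>0 -<+ -<+ = +<+ (s≤s z≤n)

  i*j>0⇒i>0 : ∀ {i j} → + 0 < j → + 0 < i * j → + 0 < i
  i*j>0⇒i>0 {+[1+ m ]} _ _ = +<+ (s≤s z≤n)
  i*j>0⇒i>0 {+0} _ 0<0 = ⊥-elim (<-irrefl refl 0<0)
  i*j>0⇒i>0 { -[1+ m ]} (+<+ (s≤s _)) ()

  i*j<0⇒i<0 : ∀ {i j} → + 0 < j → i * j < + 0 → i < + 0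
  i*j<0⇒i<0 { -[1+ m ]} _ _ = -<+
  i*j<0⇒i<0 {+0} _ 0<0 = ⊥-elim (<-irrefl refl 0<0)
  i*j<0⇒i<0 {+[1+ m ]} (+<+ (s≤s _)) (+<+ ())

module Approximation (L : ℕ) where

  open import Defs
  open import Data.Nat as ℕ using (ℕ; zero; suc)
  import Data.Nat.Properties as ℕ
  open import Data.Integer using (ℤ; +_; -_; _+_; _*_; _-_)
  import Data.Integer.Properties as ℤ
  open import Data.Integer.Tactic.RingSolver using (solve-∀)
  open import Data.Product using (_,_)
  open import Relation.Binary.PropositionalEquality
  open ZβArithmetic using (+qq-rec; mulβ-βelt)

  Q : ℕ → ℤ
  Q i = + qq L i

  -- With Q i = q_(i-1), approx k (a , b) = a q_k + b q_(k-1); since q_(k-1) / q_k → β,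
  -- for large k it has the sign of a + bβ.
  approx : ℕ → Zβ → ℤ
  approx k (a , b) = a * Q (suc k) + b * Q k

  approx-⊕ : ∀ k x y → approx k (x ⊕ y) ≡ approx k x + approx k y
  approx-⊕ k (a , b) (c , d) = distrib a b c d (Q (suc k)) (Q k)
    where
    distrib : ∀ a b c d q q′ → (a + c) * q + (b + d) * q′ ≡ (a * q + b * q′) + (c * q + d * q′)
    distrib = solve-∀

  approx-⊝ : ∀ k x y → approx k (x ⊝ y) ≡ approx k x - approx k y
  approx-⊝ k (a , b) (c , d) = distrib a b c d (Q (suc k)) (Q k)
    where
    distrib : ∀ a b c d q q′ → (a + - c) * q + (b + - d) * q′ ≡ (a * q + b * q′) - (c * q + d * q′)
    distrib = solve-∀

  approx-scal : ∀ k c x → approx k (scal c x) ≡ c * approx k x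
  approx-scal k c (a , b) = distrib c a b (Q (suc k)) (Q k)
    where
    distrib : ∀ c a b q q′ → c * a * q + c * b * q′ ≡ c * (a * q + b * q′)
    distrib = solve-∀

  approx-rec : ∀ k x → approx (suc (suc k)) x ≡ + L * approx (suc k) x + approx k x
  approx-rec k (a , b) =
    trans (cong₂ (λ u v → a * u + b * v) (+qq-rec L (suc k)) (+qq-rec L k))
          (distrib (+ L) a b (Q (suc (suc k))) (Q (suc k)) (Q k))
    where
    distrib : ∀ l a b q q′ q″ → a * (l * q + q′) + b * (l * q′ + q″) ≡ l * (a * q + b * q′) + (a * q′ + b * q″)
    distrib = solve-∀

  approx-mulβ : ∀ k x → approx (suc k) (mulβ L βelt x) ≡ approx k x
  approx-mulβ k (a , b) = begin
    approx (suc k) (mulβ L βelt (a , b))        ≡⟨ cong (approx (suc k)) (mulβ-βelt L a b) ⟩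
    b * Q (suc (suc k)) + (a - + L * b) * Q (suc k) ≡⟨ cong (λ u → b * u + (a - + L * b) * Q (suc k)) (+qq-rec L k) ⟩
    b * (+ L * Q (suc k) + Q k) + (a - + L * b) * Q (suc k) ≡⟨ lemma (+ L) a b (Q (suc k)) (Q k) ⟩
    approx k (a , b)                            ∎
    where
    open ≡-Reasoning
    lemma : ∀ l a b q q′ → b * (l * q + q′) + (a - l * b) * q ≡ a * q + b * q′
    lemma = solve-∀

  approx-one : ∀ k → approx k oneβ ≡ Q (suc k)
  approx-one k = lemma (Q (suc k)) (Q k)
    where
    lemma : ∀ q q′ → + 1 * q + + 0 * q′ ≡ q
    lemma = solve-∀

  approx-at-0 : ∀ a b → approx 0 (a , b) ≡ b
  approx-at-0 a b = identity a b
    where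
    identity : ∀ a b → a * + 0 + b * + 1 ≡ b
    identity = solve-∀

  approx-at-1 : ∀ a b → approx 1 (a , b) ≡ a
  approx-at-1 a b = trans (cong (λ q → a * q + b * + 0) (+qq-rec L 0)) (identity (+ L) a b)
    where
    identity : ∀ l a b → a * (l * + 0 + + 1) + b * + 0 ≡ a
    identity = solve-∀

  approx-βpow : ∀ j k → approx (j ℕ.+ k) (βpow L k) ≡ Q (suc j)
  approx-βpow j zero rewrite ℕ.+-identityʳ j = approx-one j
  approx-βpow j (suc k) rewrite ℕ.+-suc j k = trans (approx-mulβ (j ℕ.+ k) (βpow L k)) (approx-βpow j k)

module EventualOrder (L : ℕ) (1≤L : 1 ℕ.≤ L) where

  open import Defs
  open import Data.Nat as ℕ using (ℕ; zero; suc; z≤n; s≤s)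
  import Data.Nat.Properties as ℕ
  open import Data.Integer hiding (suc)
  open import Data.Integer.Properties
  open import Data.Integer.Tactic.RingSolver using (solve-∀)
  open import Data.Product using (Σ; _×_; _,_; uncurry)
  open import Data.Sum using (_⊎_; inj₁; inj₂)
  open import Data.Empty using (⊥-elim)
  open import Relation.Binary using (tri<; tri≈; tri>)
  open import Relation.Binary.PropositionalEquality
  open IntegerSigns
  open ZβArithmetic using (scal-identity; +qq-rec; ⊝≡zeroβ⇒≡)
  open Approximation L

  Eventually : (ℕ → Set) → Set
  Eventually P = Σ ℕ λ m → ∀ k → m ℕ.≤ k → P k

  eventually-zip : ∀ {P R : ℕ → Set} → Eventually P → Eventually R → Eventually (λ k → P k × R k)
  eventually-zip (m , p) (m′ , r) =
    m ℕ.+ m′ , λ k m+m′≤k → p k (ℕ.≤-trans (ℕ.m≤m+n m m′) m+m′≤k) , r k (ℕ.≤-trans (ℕ.m≤n+m m′ m) m+m′≤k)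

  eventually-map : ∀ {P R : ℕ → Set} → (∀ k → P k → R k) → Eventually P → Eventually R
  eventually-map f (m , p) = m , λ k m≤k → f k (p k m≤k)

  eventually-from : ∀ {P : ℕ → Set} m → (∀ j → P (j ℕ.+ m)) → Eventually P
  eventually-from {P} m p = m , λ k m≤k → subst P (ℕ.m∸n+n≡m m≤k) (p (k ℕ.∸ m))

  infix 4 _≼_ _≺_

  -- Records rather than plain definitions, so that x and y can be inferred (approx is not injective).
  record _≼_ (x y : Zβ) : Set where
    constructor eventually-≤
    field ≤-eventually : Eventually (λ k → approx k x ≤ approx k y)

  record _≺_ (x y : Zβ) : Set where
    constructor eventually-<
    field <-eventually : Eventually (λ k → approx k x < approx k y)

  ≼-reflexive : ∀ {x y} → x ≡ y → x ≼ y
  ≼-reflexive refl = eventually-≤ (0 , λ _ _ → ≤-refl)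

  ≼-trans : ∀ {x y z} → x ≼ y → y ≼ z → x ≼ z
  ≼-trans (eventually-≤ x≼y) (eventually-≤ y≼z) =
    eventually-≤ (eventually-map (λ _ → uncurry ≤-trans) (eventually-zip x≼y y≼z))

  ⊕-mono-≼ : ∀ {x y u v} → x ≼ y → u ≼ v → x ⊕ u ≼ y ⊕ v
  ⊕-mono-≼ {x} {y} {u} {v} (eventually-≤ x≼y) (eventually-≤ u≼v) =
    eventually-≤ (eventually-map mono (eventually-zip x≼y u≼v))
    where
    mono : ∀ k → approx k x ≤ approx k y × approx k u ≤ approx k v → approx k (x ⊕ u) ≤ approx k (y ⊕ v)
    mono k (p , q) = subst₂ _≤_ (sym (approx-⊕ k x u)) (sym (approx-⊕ k y v)) (+-mono-≤ p q)

  ⊕-monoʳ-≼ : ∀ x {u v} → u ≼ v → x ⊕ u ≼ x ⊕ v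
  ⊕-monoʳ-≼ x {u} {v} = ⊕-mono-≼ {x} {x} {u} {v} (≼-reflexive refl)

  scal-nonNeg : ∀ i {x} → zeroβ ≼ x → zeroβ ≼ scal (+ i) x
  scal-nonNeg i {x} (eventually-≤ 0≼x) = eventually-≤ (eventually-map scaled 0≼x)
    where
    scaled : ∀ k → + 0 ≤ approx k x → + 0 ≤ approx k (scal (+ i) x)
    scaled k 0≤x = subst (+ 0 ≤_) (sym (approx-scal k (+ i) x)) (nonNeg*nonNeg≥0 {+ i} (+≤+ z≤n) 0≤x)

  ≺-from-gap : ∀ {x g y} → zeroβ ≺ g → x ⊕ g ≼ y → x ≺ y
  ≺-from-gap {x} {g} {y} (eventually-< 0≺g) (eventually-≤ x⊕g≼y) =
    eventually-< (eventually-map strict (eventually-zip 0≺g x⊕g≼y))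
    where
    strict : ∀ k → + 0 < approx k g × approx k (x ⊕ g) ≤ approx k y → approx k x < approx k y
    strict k (0<g , x⊕g≤y) = begin-strict
      approx k x                 ≡⟨ sym (+-identityʳ (approx k x)) ⟩
      approx k x + + 0           <⟨ +-monoʳ-< (approx k x) 0<g ⟩
      approx k x + approx k g    ≡⟨ sym (approx-⊕ k x g) ⟩
      approx k (x ⊕ g)           ≤⟨ x⊕g≤y ⟩
      approx k y                 ∎
      where open ≤-Reasoning

  qq-pos : ∀ i → 1 ℕ.≤ qq L (suc (suc i))
  qq-pos zero = ℕ.m≤n+m 1 (L ℕ.* 0)
  qq-pos (suc i) = ℕ.≤-trans (ℕ.*-mono-≤ 1≤L (qq-pos i)) (ℕ.m≤m+n (L ℕ.* qq L (suc (suc i))) (qq L (suc i)))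

  approx-βpow-late : ∀ j n → approx (j ℕ.+ suc n) (βpow L n) ≡ Q (suc (suc j))
  approx-βpow-late j n = trans (cong (λ k → approx k (βpow L n)) (ℕ.+-suc j n)) (approx-βpow (suc j) n)

  zero≺βpow : ∀ n → zeroβ ≺ βpow L n
  zero≺βpow n = eventually-< (eventually-from (suc n) λ j →
    subst (+ 0 <_) (sym (approx-βpow-late j n)) (+<+ (qq-pos j)))

  zero≼βpow : ∀ n → zeroβ ≼ βpow L n
  zero≼βpow n = eventually-≤ (eventually-map (λ _ → <⇒≤) (_≺_.<-eventually (zero≺βpow n)))

  scal-βpow-≼ : ∀ {i} n → i ℕ.≤ L → scal (+ i) (βpow L (suc n)) ≼ βpow L n
  scal-βpow-≼ {i} n i≤L = eventually-≤ (eventually-from (suc n) λ j → begin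
    approx (j ℕ.+ suc n) (scal (+ i) (βpow L (suc n)))   ≡⟨ approx-scal (j ℕ.+ suc n) (+ i) (βpow L (suc n)) ⟩
    + i * approx (j ℕ.+ suc n) (βpow L (suc n))          ≡⟨ cong (+ i *_) (approx-βpow j (suc n)) ⟩
    + i * Q (suc j)                                       ≡⟨ sym (pos-* i (qq L (suc j))) ⟩
    + (i ℕ.* qq L (suc j))                                ≤⟨ +≤+ (ℕ.≤-trans (ℕ.*-monoˡ-≤ (qq L (suc j)) i≤L) (ℕ.m≤m+n _ (qq L j))) ⟩
    Q (suc (suc j))                                       ≡⟨ sym (approx-βpow-late j n) ⟩
    approx (j ℕ.+ suc n) (βpow L n)                      ∎)
    where open ≤-Reasoning

  βpow-suc-≼ : ∀ n → βpow L (suc n) ≼ βpow L n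
  βpow-suc-≼ n = subst (_≼ βpow L n) (scal-identity (βpow L (suc n))) (scal-βpow-≼ n 1≤L)

  norm : Zβ → ℤ
  norm (a , b) = a * a - + L * a * b - b * b

  disc : ℤ
  disc = + (L ℕ.* L ℕ.+ 4)

  -- Pos L (a , b) compares u = 2a − bL with b√disc, and u² − b² disc = 4 · norm (a , b).
  square-norm : ∀ a b → (+ 2 * a - b * + L) * (+ 2 * a - b * + L) ≡ b * b * disc + norm (a , b) * + 4
  square-norm a b = trans (identity (+ L) a b) (cong (λ D → b * b * D + norm (a , b) * + 4) (sym D≡))
    where
    identity : ∀ l a b → (+ 2 * a - b * l) * (+ 2 * a - b * l) ≡ b * b * (l * l + + 4) + (a * a - l * a * b - b * b) * + 4
    identity = solve-∀
    D≡ : disc ≡ + L * + L + + 4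
    D≡ = trans (pos-+ (L ℕ.* L) 4) (cong (_+ + 4) (pos-* L L))

  Pos-b≡0 : ∀ {a} → + 0 < a → Pos L (a , + 0)
  Pos-b≡0 {a} 0<a = inj₁ (subst (+ 0 <_) (identity a (+ L)) (pos*pos>0 {+ 2} (+<+ (s≤s z≤n)) 0<a) , +≤+ z≤n)
    where
    identity : ∀ a l → + 2 * a ≡ + 2 * a - + 0 * l
    identity = solve-∀

  Pos-b>0 : ∀ {a b} → + 0 < b → (a - + L * b < + 0 → norm (a , b) < + 0) → Pos L (a , b)
  Pos-b>0 {a} {b} 0<b norm<0 with <-cmp (+ 2 * a - b * + L) (+ 0)
  ... | tri> _ _ 0<u = inj₂ (inj₁ (<⇒≤ 0<u , 0<b))
  ... | tri≈ _ u≡0 _ = inj₂ (inj₁ (≤-reflexive (sym u≡0) , 0<b))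
  ... | tri< u<0 _ _ = inj₂ (inj₂ (inj₂ (u<0 , 0<b , u²<b²D)))
    where
    u = + 2 * a - b * + L
    a-Lb<0 : a - + L * b < + 0
    a-Lb<0 = i*j<0⇒i<0 (+<+ (s≤s z≤n)) (subst (_< + 0) (identity a b (+ L))
               (+-mono-<-≤ u<0 (neg-mono-≤ (nonNeg*nonNeg≥0 (<⇒≤ 0<b) (+≤+ z≤n)))))
      where
      identity : ∀ a b l → (+ 2 * a - b * l) + - (b * l) ≡ (a - l * b) * + 2
      identity = solve-∀
    u²<b²D : u * u < b * b * disc
    u²<b²D = begin-strict
      u * u                                                   ≡⟨ square-norm a b ⟩
      b * b * disc + norm (a , b) * + 4           <⟨ +-monoʳ-< (b * b * disc) (neg*pos<0 (norm<0 a-Lb<0) (+<+ (s≤s z≤n))) ⟩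
      b * b * disc + + 0                          ≡⟨ +-identityʳ _ ⟩
      b * b * disc                                ∎
      where open ≤-Reasoning

  Pos-b<0 : ∀ {a b} → b < + 0 → + 0 < a → + 0 < norm (a , b) → Pos L (a , b)
  Pos-b<0 {a} {b} b<0 0<a 0<norm = inj₂ (inj₂ (inj₁ (0<u , b<0 , b²D<u²)))
    where
    0<u : + 0 < + 2 * a - b * + L
    0<u = subst (+ 0 <_) (identity a b (+ L))
            (+-mono-<-≤ (pos*pos>0 {+ 2} (+<+ (s≤s z≤n)) 0<a) (nonNeg*nonNeg≥0 (<⇒≤ (neg-mono-< b<0)) (+≤+ z≤n)))
      where
      identity : ∀ a b l → + 2 * a + (- b) * l ≡ + 2 * a - b * l
      identity = solve-∀
    b²D<u² : b * b * disc < (+ 2 * a - b * + L) * (+ 2 * a - b * + L)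
    b²D<u² = begin-strict
      b * b * disc                                ≡⟨ sym (+-identityʳ _) ⟩
      b * b * disc + + 0                          <⟨ +-monoʳ-< (b * b * disc) (pos*pos>0 0<norm (+<+ (s≤s z≤n))) ⟩
      b * b * disc + norm (a , b) * + 4           ≡⟨ sym (square-norm a b) ⟩
      (+ 2 * a - b * + L) * (+ 2 * a - b * + L)                ∎
      where open ≤-Reasoning

  cassini : ℕ → ℤ
  cassini k = Q k * Q k + + L * Q k * Q (suc k) - Q (suc k) * Q (suc k)

  cassini-suc : ∀ k → cassini (suc k) ≡ - cassini k
  cassini-suc k = trans (cong (λ q → Q (suc k) * Q (suc k) + + L * Q (suc k) * q - q * q) (+qq-rec L k))
                        (identity (+ L) (Q k) (Q (suc k)))
    where
    identity : ∀ l p q → q * q + l * q * (l * q + p) - (l * q + p) * (l * q + p) ≡ - (p * p + l * p * q - q * q)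
    identity = solve-∀

  cassini-even : ∀ j → cassini (j ℕ.+ j) ≡ + 1
  cassini-even zero = identity (+ L)
    where
    identity : ∀ l → + 1 * + 1 + l * + 1 * + 0 - + 0 * + 0 ≡ + 1
    identity = solve-∀
  cassini-even (suc j) rewrite ℕ.+-suc j j =
    trans (cassini-suc (suc (j ℕ.+ j))) (trans (cong -_ (cassini-suc (j ℕ.+ j))) (trans (neg-involutive _) (cassini-even j)))

  cassini-odd : ∀ j → cassini (suc (j ℕ.+ j)) ≡ - + 1
  cassini-odd j = trans (cassini-suc (j ℕ.+ j)) (cong -_ (cassini-even j))

  -- Both identities express q_k² · norm x through s = approx k x and Cassini's identity
  -- q_(k-1)² + L q_(k-1) q_k − q_k² = (−1)^k.
  norm-cassini₁ : ∀ k a b → norm (a , b) * (Q (suc k) * Q (suc k))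
                  ≡ ((a - + L * b) * Q (suc k) - b * Q k) * approx k (a , b) + b * b * cassini k
  norm-cassini₁ k a b = identity (+ L) a b (Q k) (Q (suc k))
    where
    identity : ∀ l a b p q → (a * a - l * a * b - b * b) * (q * q)
               ≡ ((a - l * b) * q - b * p) * (a * q + b * p) + b * b * (p * p + l * p * q - q * q)
    identity = solve-∀

  norm-cassini₂ : ∀ k a b → norm (a , b) * (Q (suc k) * Q (suc k))
                  ≡ approx k (a , b) * approx k (a , b) + approx k (a , b) * (- b) * (+ 2 * Q k + + L * Q (suc k)) + b * b * cassini k
  norm-cassini₂ k a b = identity (+ L) a b (Q k) (Q (suc k))
    where
    identity : ∀ l a b p q → (a * a - l * a * b - b * b) * (q * q)
               ≡ (a * q + b * p) * (a * q + b * p) + (a * q + b * p) * (- b) * (+ 2 * p + l * q) + b * b * (p * p + l * p * q - q * q)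
    identity = solve-∀

  Q-pos : ∀ i → + 0 < Q (suc (suc i))
  Q-pos i = +<+ (qq-pos i)

  a>0-from-approx : ∀ {a b} k → b ≤ + 0 → + 0 < approx (suc k) (a , b) → + 0 < a
  a>0-from-approx {a} {b} k b≤0 0<s = i*j>0⇒i>0 (Q-pos k) (begin-strict
    + 0                                               <⟨ +-mono-<-≤ 0<s (nonNeg*nonNeg≥0 (neg-mono-≤ b≤0) (+≤+ z≤n)) ⟩
    approx (suc k) (a , b) + (- b) * Q (suc k)        ≡⟨ identity a b (Q (suc (suc k))) (Q (suc k)) ⟩
    a * Q (suc (suc k))                               ∎)
    where
    open ≤-Reasoning
    identity : ∀ a b q p → (a * q + b * p) + (- b) * p ≡ a * q
    identity = solve-∀

  norm<0-from-approx : ∀ {a b} j → + 0 < b → + 0 < approx (suc (j ℕ.+ j)) (a , b) → a - + L * b < + 0 → norm (a , b) < + 0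
  norm<0-from-approx {a} {b} j 0<b 0<s a-Lb<0 = i*j<0⇒i<0 (pos*pos>0 (Q-pos (j ℕ.+ j)) (Q-pos (j ℕ.+ j))) (begin-strict
    norm (a , b) * (Q (suc k) * Q (suc k))      ≡⟨ norm-cassini₁ k a b ⟩
    T * s + b * b * cassini k                   ≡⟨ cong (λ c → T * s + b * b * c) (cassini-odd j) ⟩
    T * s + b * b * - + 1                       ≡⟨ sym (+-identityʳ _) ⟩
    T * s + b * b * - + 1 + + 0                 <⟨ +-monoʳ-< (T * s + b * b * - + 1) (pos*pos>0 0<b 0<b) ⟩
    T * s + b * b * - + 1 + b * b               ≡⟨ identity (T * s) (b * b) ⟩
    T * s                                       <⟨ neg*pos<0 T<0 0<s ⟩
    + 0                                         ∎)
    where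
    open ≤-Reasoning
    k = suc (j ℕ.+ j)
    s = approx k (a , b)
    T = (a - + L * b) * Q (suc k) - b * Q k
    T<0 : T < + 0
    T<0 = +-mono-<-≤ (neg*pos<0 a-Lb<0 (Q-pos (j ℕ.+ j))) (neg-mono-≤ (nonNeg*nonNeg≥0 (<⇒≤ 0<b) (+≤+ z≤n)))
    identity : ∀ t c → t + c * - + 1 + c ≡ t
    identity = solve-∀

  norm>0-from-approx : ∀ {a b} j → b < + 0 → + 0 < approx (suc (suc (j ℕ.+ j))) (a , b) → + 0 < norm (a , b)
  norm>0-from-approx {a} {b} j b<0 0<s = i*j>0⇒i>0 (pos*pos>0 (Q-pos (suc (j ℕ.+ j))) (Q-pos (suc (j ℕ.+ j)))) (begin-strict
    + 0                                         <⟨ +-mono-<-≤ (+-mono-<-≤ (pos*pos>0 0<s 0<s) 0≤middle) 0≤b² ⟩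
    s * s + s * (- b) * w + b * b * + 1         ≡⟨ cong (λ c → s * s + s * (- b) * w + b * b * c) (sym cassini-k) ⟩
    s * s + s * (- b) * w + b * b * cassini k   ≡⟨ sym (norm-cassini₂ k a b) ⟩
    norm (a , b) * (Q (suc k) * Q (suc k))      ∎)
    where
    open ≤-Reasoning
    k = suc (suc (j ℕ.+ j))
    s = approx k (a , b)
    w = + 2 * Q k + + L * Q (suc k)
    cassini-k : cassini k ≡ + 1
    cassini-k = trans (cassini-suc (suc (j ℕ.+ j))) (cong -_ (cassini-odd j))
    0≤middle : + 0 ≤ s * (- b) * w
    0≤middle = nonNeg*nonNeg≥0 (nonNeg*nonNeg≥0 (<⇒≤ 0<s) (<⇒≤ (neg-mono-< b<0)))
                 (+-mono-≤ (nonNeg*nonNeg≥0 {+ 2} {Q k} (+≤+ z≤n) (+≤+ z≤n)) (nonNeg*nonNeg≥0 {+ L} {Q (suc k)} (+≤+ z≤n) (+≤+ z≤n)))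
    0≤b² : + 0 ≤ b * b * + 1
    0≤b² = nonNeg*nonNeg≥0 (<⇒≤ (neg*neg>0 b<0 b<0)) (+≤+ z≤n)

  -- Cassini's term has sign (−1)^k, so positivity at one odd and the following even index suffices.
  Pos-from-odd-even : ∀ x j → + 0 < approx (suc (j ℕ.+ j)) x → + 0 < approx (suc (suc (j ℕ.+ j))) x → Pos L x
  Pos-from-odd-even (a , b) j 0<s-odd 0<s-even with <-cmp (+ 0) b
  ... | tri≈ _ refl _ = Pos-b≡0 (a>0-from-approx {a} (j ℕ.+ j) ≤-refl 0<s-odd)
  ... | tri< 0<b _ _ = Pos-b>0 {a} 0<b (norm<0-from-approx {a} j 0<b 0<s-odd)
  ... | tri> _ _ b<0 = Pos-b<0 b<0 (a>0-from-approx {a} (suc (j ℕ.+ j)) (<⇒≤ b<0) 0<s-even) (norm>0-from-approx {a} j b<0 0<s-even)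

  Pos-from-approx : ∀ x → Eventually (λ k → + 0 < approx k x) → Pos L x
  Pos-from-approx x (m , 0<s) =
    Pos-from-odd-even x m (0<s (suc (m ℕ.+ m)) m≤odd) (0<s (suc (suc (m ℕ.+ m))) (ℕ.≤-trans m≤odd (ℕ.n≤1+n _)))
    where
    m≤odd : m ℕ.≤ suc (m ℕ.+ m)
    m≤odd = ℕ.≤-trans (ℕ.m≤m+n m m) (ℕ.n≤1+n _)

  approx-vanishing : ∀ x m → approx m x ≡ + 0 → approx (suc m) x ≡ + 0 → x ≡ zeroβ
  approx-vanishing (a , b) zero s₀≡0 s₁≡0 =
    cong₂ _,_ (trans (sym (approx-at-1 a b)) s₁≡0) (trans (sym (approx-at-0 a b)) s₀≡0)
  approx-vanishing x (suc m) s₁≡0 s₂≡0 = approx-vanishing x m s₀≡0 s₁≡0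
    where
    s₀≡0 : approx m x ≡ + 0
    s₀≡0 = begin
      approx m x                                  ≡⟨ sym (identity (+ L) (approx m x)) ⟩
      + L * + 0 + approx m x                      ≡⟨ cong (λ s → + L * s + approx m x) (sym s₁≡0) ⟩
      + L * approx (suc m) x + approx m x         ≡⟨ sym (approx-rec m x) ⟩
      approx (suc (suc m)) x                      ≡⟨ s₂≡0 ⟩
      + 0                                         ∎
      where
      open ≡-Reasoning
      identity : ∀ l s → l * + 0 + s ≡ s
      identity = solve-∀

  positivity-persists : ∀ x m → (∀ k → m ℕ.≤ k → + 0 ≤ approx k x) →
                        ∀ k → m ℕ.≤ k → + 0 < approx (suc k) x → Eventually (λ k → + 0 < approx k x)
  positivity-persists x m 0≤s k m≤k 0<s =
    eventually-from (suc k) λ j → subst (λ i → + 0 < approx i x) (sym (ℕ.+-suc j k)) (persist j)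
    where
    persist : ∀ j → + 0 < approx (suc (j ℕ.+ k)) x
    persist zero = 0<s
    persist (suc j) = subst (+ 0 <_) (sym (approx-rec (j ℕ.+ k) x))
      (+-mono-<-≤ (pos*pos>0 (+<+ 1≤L) (persist j)) (0≤s (j ℕ.+ k) (ℕ.≤-trans m≤k (ℕ.m≤n+m k j))))

  zero-or-Pos-from-approx : ∀ x → Eventually (λ k → + 0 ≤ approx k x) → x ≡ zeroβ ⊎ Pos L x
  zero-or-Pos-from-approx x (m , 0≤s) with <-cmp (+ 0) (approx (suc m) x) | <-cmp (+ 0) (approx m x)
  ... | tri< 0<s₁ _ _ | _ = inj₂ (Pos-from-approx x (positivity-persists x m 0≤s m ℕ.≤-refl 0<s₁))
  ... | tri≈ _ 0≡s₁ _ | tri< 0<s₀ _ _ = inj₂ (Pos-from-approx x (positivity-persists x m 0≤s (suc m) (ℕ.n≤1+n m) 0<s₂))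
    where
    0<s₂ : + 0 < approx (suc (suc m)) x
    0<s₂ = subst (+ 0 <_) (sym (approx-rec m x))
             (+-mono-≤-< (nonNeg*nonNeg≥0 {+ L} (+≤+ z≤n) (0≤s (suc m) (ℕ.n≤1+n m))) 0<s₀)
  ... | tri≈ _ 0≡s₁ _ | tri≈ _ 0≡s₀ _ = inj₁ (approx-vanishing x m (sym 0≡s₀) (sym 0≡s₁))
  ... | tri≈ _ _ _ | tri> _ _ s₀<0 = ⊥-elim (<⇒≱ s₀<0 (0≤s m ℕ.≤-refl))
  ... | tri> _ _ s₁<0 | _ = ⊥-elim (<⇒≱ s₁<0 (0≤s (suc m) (ℕ.n≤1+n m)))

  ≼⇒≤ : ∀ {x y} → x ≼ y → x ≤[ L ] y
  ≼⇒≤ {x} {y} (eventually-≤ x≼y) with zero-or-Pos-from-approx (y ⊝ x) (eventually-map difference x≼y)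
    where
    difference : ∀ k → approx k x ≤ approx k y → + 0 ≤ approx k (y ⊝ x)
    difference k x≤y = subst (+ 0 ≤_) (sym (approx-⊝ k y x)) (i≤j⇒0≤j-i x≤y)
  ... | inj₁ y⊝x≡0 = inj₁ (sym (⊝≡zeroβ⇒≡ y x y⊝x≡0))
  ... | inj₂ 0<y⊝x = inj₂ 0<y⊝x

  ≺⇒< : ∀ {x y} → x ≺ y → x <[ L ] y
  ≺⇒< {x} {y} (eventually-< x≺y) = Pos-from-approx (y ⊝ x) (eventually-map difference x≺y)
    where
    difference : ∀ k → approx k x < approx k y → + 0 < approx k (y ⊝ x)
    difference k x<y = subst₂ _<_ (+-inverseʳ (approx k x)) (sym (approx-⊝ k y x)) (+-monoˡ-< (- approx k x) x<y)

module ListLemmas where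

  open import Data.Nat using (ℕ; zero; suc; _<_; z≤n; s≤s)
  open import Data.List using (List; []; _∷_; _++_; applyUpTo; take; length)
  open import Relation.Binary.PropositionalEquality using (_≡_; refl; cong; cong₂)

  take-length-++ : ∀ {A : Set} (xs ys : List A) → take (length xs) (xs ++ ys) ≡ xs
  take-length-++ [] ys = refl
  take-length-++ (x ∷ xs) ys = cong (x ∷_) (take-length-++ xs ys)

  applyUpTo-cong : ∀ {A : Set} {f g : ℕ → A} n → (∀ i → i < n → f i ≡ g i) → applyUpTo f n ≡ applyUpTo g n
  applyUpTo-cong zero f≡g = refl
  applyUpTo-cong (suc n) f≡g = cong₂ _∷_ (f≡g 0 (s≤s z≤n)) (applyUpTo-cong n λ i i<n → f≡g (suc i) (s≤s i<n))

module IntegerRanges where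

  open import Data.Nat as ℕ using (ℕ; zero; suc; z≤n; s≤s)
  import Data.Nat.Properties as ℕ
  open import Data.Integer renaming (suc to sucℤ)
  open import Data.Integer.Properties
  open import Data.Integer.Tactic.RingSolver using (solve-∀)
  open import Data.List using (List; []; _∷_; _++_; map; length; applyUpTo)
  open import Data.List.Membership.Propositional using (_∈_)
  open import Data.List.Relation.Unary.Any using (here; there)
  open import Data.Product using (Σ; _×_; _,_)
  open import Data.Empty using (⊥-elim)
  open import Relation.Binary using (tri<; tri≈; tri>)
  open import Relation.Binary.PropositionalEquality
  open ListLemmas using (applyUpTo-cong)

  range : ℤ → ℕ → List ℤ
  range lo zero = []
  range lo (suc len) = sucℤ lo ∷ range (sucℤ lo) len

  length-range : ∀ lo len → length (range lo len) ≡ len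
  length-range lo zero = refl
  length-range lo (suc len) = cong suc (length-range (sucℤ lo) len)

  map-+-range : ∀ σ lo len → map (_+ σ) (range lo len) ≡ range (lo + σ) len
  map-+-range σ lo zero = refl
  map-+-range σ lo (suc len) = cong₂ _∷_ (shift lo σ) (trans (map-+-range σ (sucℤ lo) len) (cong (λ lo′ → range lo′ len) (shift lo σ)))
    where
    shift : ∀ lo σ → (+ 1 + lo) + σ ≡ + 1 + (lo + σ)
    shift = solve-∀

  shift-range : ∀ lo a → sucℤ lo + a ≡ lo + (+ 1 + a)
  shift-range lo a = identity lo a
    where
    identity : ∀ lo a → (+ 1 + lo) + a ≡ lo + (+ 1 + a)
    identity = solve-∀

  range-++ : ∀ lo a b → range lo (a ℕ.+ b) ≡ range lo a ++ range (lo + + a) b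
  range-++ lo zero b = cong (λ lo′ → range lo′ b) (sym (+-identityʳ lo))
  range-++ lo (suc a) b =
    cong (sucℤ lo ∷_) (trans (range-++ (sucℤ lo) a b) (cong (λ lo′ → range (sucℤ lo) a ++ range lo′ b) (shift-range lo (+ a))))

  range-applyUpTo : ∀ lo n → range lo n ≡ applyUpTo (λ i → lo + + suc i) n
  range-applyUpTo lo zero = refl
  range-applyUpTo lo (suc n) = cong₂ _∷_ (+-comm (+ 1) lo)
    (trans (range-applyUpTo (sucℤ lo) n) (applyUpTo-cong n λ i _ → shift-range lo (+ suc i)))

  i<suc[i] : ∀ i → i < sucℤ i
  i<suc[i] i = suc[i]≤j⇒i<j ≤-refl

  ∈-range⁻ : ∀ {z} lo len → z ∈ range lo len → lo < z × z ≤ lo + + len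
  ∈-range⁻ lo (suc len) (here refl) =
    i<suc[i] lo , subst (_≤ lo + + suc len) (+-comm lo (+ 1)) (+-monoʳ-≤ lo (+≤+ (s≤s z≤n)))
  ∈-range⁻ lo (suc len) (there z∈) with ∈-range⁻ (sucℤ lo) len z∈
  ... | suc[lo]<z , z≤ = <-trans (i<suc[i] lo) suc[lo]<z , subst (_ ≤_) (shift-range lo (+ len)) z≤

  ∈-range⁺ : ∀ {z} lo len → lo < z → z ≤ lo + + len → z ∈ range lo len
  ∈-range⁺ lo zero lo<z z≤lo = ⊥-elim (<⇒≱ lo<z (subst (_ ≤_) (+-identityʳ lo) z≤lo))
  ∈-range⁺ {z} lo (suc len) lo<z z≤ with <-cmp (sucℤ lo) z
  ... | tri≈ _ suc[lo]≡z _ = here (sym suc[lo]≡z)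
  ... | tri< suc[lo]<z _ _ = there (∈-range⁺ (sucℤ lo) len suc[lo]<z (subst (z ≤_) (sym (shift-range lo (+ len))) z≤))
  ... | tri> _ _ z<suc[lo] = ⊥-elim (<⇒≱ z<suc[lo] (i<j⇒suc[i]≤j lo<z))

  nonNeg-window : ∀ {a b w} → + a ≤ w → w < + b → Σ ℕ λ m → a ℕ.≤ m × m ℕ.< b × w ≡ + m
  nonNeg-window {w = + m} (+≤+ a≤m) (+<+ m<b) = m , a≤m , m<b , refl

  pos-window⁻ : ∀ {a b z} → + a < z → z ≤ + b → Σ ℕ λ m → a ℕ.+ 1 ℕ.≤ m × m ℕ.≤ b × z ≡ + m
  pos-window⁻ {a} {z = + m} (+<+ a<m) (+≤+ m≤b) = m , subst (ℕ._≤ m) (ℕ.+-comm 1 a) a<m , m≤b , refl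

  pos-window⁺ : ∀ {a b m} → a ℕ.+ 1 ℕ.≤ m → m ℕ.≤ b → + a < + m × + m ≤ + b
  pos-window⁺ {a} {m = m} a+1≤m m≤b = +<+ (subst (ℕ._≤ m) (ℕ.+-comm a 1) a+1≤m) , +≤+ m≤b

  neg-window⁻ : ∀ {a b z} → - + b < z → z ≤ - + a → Σ ℕ λ m → a ℕ.≤ m × m ℕ.≤ b ℕ.∸ 1 × z ≡ - + m
  neg-window⁻ {a} {b} {z} -b<z z≤-a with nonNeg-window (subst (_≤ - z) (neg-involutive (+ a)) (neg-mono-≤ z≤-a))
                                                       (subst (- z <_) (neg-involutive (+ b)) (neg-mono-< -b<z))
  ... | m , a≤m , m<b , -z≡m = m , a≤m , ℕ.suc[m]≤n⇒m≤pred[n] m<b , trans (sym (neg-involutive z)) (cong -_ -z≡m)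

  neg-window⁺ : ∀ {a b m} → 1 ℕ.≤ b → a ℕ.≤ m → m ℕ.≤ b ℕ.∸ 1 → - + b < - + m × - + m ≤ - + a
  neg-window⁺ {b = suc _} _ a≤m m≤b-1 = neg-mono-< (+<+ (s≤s m≤b-1)) , neg-mono-≤ (+≤+ a≤m)

module LSSequence (ℓ : ℕ) where

  open import Defs
  open import Data.Nat as ℕ using (ℕ; zero; suc; z≤n; s≤s)
  import Data.Nat.Properties as ℕ
  import Data.Nat.Tactic.RingSolver as ℕ-Solver
  open import Data.Integer as ℤ using (ℤ; +_; -_)
  import Data.Integer.Properties as ℤ
  open import Data.Integer.Tactic.RingSolver using (solve-∀)
  open import Data.List using (List; []; _∷_; _++_; map; concat; take; upTo; applyUpTo; length)
  import Data.List.Properties as List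
  open import Data.List.Membership.Propositional using (_∈_)
  open import Data.List.Membership.Propositional.Properties
  open import Data.List.Relation.Binary.Permutation.Propositional
    using (_↭_; ↭-reflexive; ↭-sym; ↭-trans; module PermutationReasoning)
  open import Data.List.Relation.Binary.Permutation.Propositional.Properties
    using (↭-length; ++⁺; ++-comm; shifts; map⁺; ∈-resp-↭)
  open import Data.Product using (Σ; _×_; _,_; proj₁; proj₂)
  open import Data.List.Relation.Unary.Any using (here; there)
  open import Data.List.Relation.Binary.Subset.Propositional using (_⊆_)
  open import Data.Sum using (_⊎_; inj₁; inj₂)
  open import Relation.Binary.PropositionalEquality
  open ZβArithmetic
  open IntegerRanges
  open ListLemmas

  L : ℕ
  L = suc ℓ

  open EventualOrder L (s≤s z≤n)

  Fits : Zβ → Zβ → Set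
  Fits x g = zeroβ ≼ x × x ⊕ g ≼ oneβ

  fits-shrink : ∀ {x} k → Fits x (βpow L k) → Fits x (βpow L (suc k))
  fits-shrink {x} k (0≼x , x⊕g≼1) = 0≼x , ≼-trans (⊕-monoʳ-≼ x (βpow-suc-≼ k)) x⊕g≼1

  fits-translate : ∀ {ξ} i k → zeroβ ≼ ξ → zeroβ ≼ ψ L k i ξ
  fits-translate {ξ} i k 0≼ξ = ⊕-mono-≼ 0≼ξ (scal-nonNeg i (zero≼βpow k))

  fits-column : ∀ {ξ i} k → i ℕ.< ℓ → Fits ξ (βpow L (suc k)) → Fits (ψ L (suc (suc k)) (suc i) ξ) (βpow L (suc (suc k)))
  fits-column {ξ} {i} k i<ℓ (0≼ξ , ξ⊕g≼1) =
    fits-translate (suc i) (suc (suc k)) 0≼ξ ,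
    ≼-trans (subst (_≼ ξ ⊕ βpow L (suc k)) (sym regroup) (⊕-monoʳ-≼ ξ (scal-βpow-≼ (suc k) (s≤s i<ℓ)))) ξ⊕g≼1
    where
    w = βpow L (suc (suc k))
    regroup : (ξ ⊕ scal (+ suc i) w) ⊕ w ≡ ξ ⊕ scal (+ suc (suc i)) w
    regroup = trans (⊕-assoc ξ (scal (+ suc i) w) w) (cong (ξ ⊕_) (sym (scal-suc (suc i) w)))

  fits-last-column : ∀ {ξ} k → Fits ξ (βpow L (suc k)) → Fits (ψ L (suc (suc k)) L ξ) (βpow L (suc (suc (suc k))))
  fits-last-column {ξ} k (0≼ξ , ξ⊕g≼1) = fits-translate L (suc (suc k)) 0≼ξ , subst (_≼ oneβ) (sym regroup) ξ⊕g≼1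
    where
    regroup : (ξ ⊕ scal (+ L) (βpow L (suc (suc k)))) ⊕ βpow L (suc (suc (suc k))) ≡ ξ ⊕ βpow L (suc k)
    regroup = trans (⊕-assoc ξ (scal (+ L) (βpow L (suc (suc k)))) (βpow L (suc (suc (suc k)))))
                    (cong (ξ ⊕_) (sym (βpow-unfold L (suc k))))

  fits⇒unit : ∀ {x} k → Fits x (βpow L k) → zeroβ ≤[ L ] x × x <[ L ] oneβ
  fits⇒unit {x} k (0≼x , x⊕g≼1) = ≼⇒≤ 0≼x , ≺⇒< (≺-from-gap {x} (zero≺βpow k) x⊕g≼1)

  column : ℕ → List Zβ → ℕ → List Zβ
  column K A i = map (ψ L K (suc i)) A

  copies : ℕ → List Zβ → ℕ → List Zβ
  copies K A k = concat (map (column K A) (upTo k))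

  copies-suc : ∀ K A k → copies K A (suc k) ≡ copies K A k ++ column K A k
  copies-suc K A k = begin
    concat (map (column K A) (upTo (suc k)))                    ≡⟨ cong (λ is → concat (map (column K A) is)) (sym (List.upTo-∷ʳ k)) ⟩
    concat (map (column K A) (upTo k ++ k ∷ []))                ≡⟨ cong concat (List.map-++ (column K A) (upTo k) (k ∷ [])) ⟩
    concat (map (column K A) (upTo k) ++ column K A k ∷ [])     ≡⟨ sym (List.concat-++ (map (column K A) (upTo k)) (column K A k ∷ [])) ⟩
    copies K A k ++ (column K A k ++ [])                         ≡⟨ cong (copies K A k ++_) (List.++-identityʳ (column K A k)) ⟩
    copies K A k ++ column K A k                                 ∎
    where open ≡-Reasoning

  ∈-copies⁻ : ∀ {K A k x} → x ∈ copies K A k → Σ ℕ λ i → i ℕ.< k × Σ Zβ λ ξ → ξ ∈ A × x ≡ ψ L K (suc i) ξ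
  ∈-copies⁻ {K} {A} {k} x∈ with ∈-concat⁻′ (map (column K A) (upTo k)) x∈
  ... | xs , x∈xs , xs∈ with ∈-map⁻ (column K A) xs∈
  ...   | i , i∈ , refl with ∈-map⁻ (ψ L K (suc i)) x∈xs
  ...     | ξ , ξ∈A , x≡ = i , ∈-upTo⁻ i∈ , ξ , ξ∈A , x≡

  length-copies : ∀ K A k → length (copies K A k) ≡ k ℕ.* length A
  length-copies K A zero = refl
  length-copies K A (suc k) = begin
    length (copies K A (suc k))                     ≡⟨ cong length (copies-suc K A k) ⟩
    length (copies K A k ++ column K A k)           ≡⟨ List.length-++ (copies K A k) ⟩
    length (copies K A k) ℕ.+ length (column K A k) ≡⟨ cong₂ ℕ._+_ (length-copies K A k) (List.length-map (ψ L K (suc k)) A) ⟩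
    k ℕ.* length A ℕ.+ length A                     ≡⟨ ℕ.+-comm (k ℕ.* length A) (length A) ⟩
    suc k ℕ.* length A                              ∎
    where open ≡-Reasoning

  coords : List Zβ → List ℤ
  coords = map proj₂

  column-coords : ∀ {K A lo len} i → coords A ↭ range lo len →
                  coords (column K A i) ↭ range (lo ℤ.+ + suc i ℤ.* proj₂ (βpow L K)) len
  column-coords {K} {A} {lo} {len} i A↭ = begin
    coords (column K A i)          ≡⟨ trans (sym (List.map-∘ A)) (List.map-∘ A) ⟩
    map (ℤ._+ σ) (coords A)        ↭⟨ map⁺ (ℤ._+ σ) A↭ ⟩
    map (ℤ._+ σ) (range lo len)    ≡⟨ map-+-range σ lo len ⟩
    range (lo ℤ.+ σ) len           ∎
    where
    open PermutationReasoning
    σ = + suc i ℤ.* proj₂ (βpow L K)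

  coords-copies-suc : ∀ K A k → coords (copies K A (suc k)) ≡ coords (copies K A k) ++ coords (column K A k)
  coords-copies-suc K A k = trans (cong coords (copies-suc K A k)) (List.map-++ proj₂ (copies K A k) (column K A k))

  copies-coords-up : ∀ {K A lo len} → proj₂ (βpow L K) ≡ + len → coords A ↭ range lo len →
                     ∀ k → coords (copies K A k) ↭ range (lo ℤ.+ + len) (k ℕ.* len)
  copies-coords-up σ≡len A↭ zero = ↭-reflexive refl
  copies-coords-up {K} {A} {lo} {len} σ≡len A↭ (suc k) = begin
    coords (copies K A (suc k))                         ≡⟨ coords-copies-suc K A k ⟩
    coords (copies K A k) ++ coords (column K A k)      ↭⟨ ++⁺ (copies-coords-up {K} σ≡len A↭ k) (column-coords {K} k A↭) ⟩
    range lo′ (k ℕ.* len) ++ range new len              ≡⟨ cong (λ l → range lo′ (k ℕ.* len) ++ range l len) new≡ ⟩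
    range lo′ (k ℕ.* len) ++ range (lo′ ℤ.+ + (k ℕ.* len)) len ≡⟨ sym (range-++ lo′ (k ℕ.* len) len) ⟩
    range lo′ (k ℕ.* len ℕ.+ len)                       ≡⟨ cong (range lo′) (ℕ.+-comm (k ℕ.* len) len) ⟩
    range lo′ (suc k ℕ.* len)                           ∎
    where
    open PermutationReasoning
    lo′ = lo ℤ.+ + len
    new = lo ℤ.+ + suc k ℤ.* proj₂ (βpow L K)
    identity : ∀ lo k n → lo ℤ.+ (+ 1 ℤ.+ k) ℤ.* n ≡ (lo ℤ.+ n) ℤ.+ k ℤ.* n
    identity = solve-∀
    new≡ : new ≡ lo′ ℤ.+ + (k ℕ.* len)
    new≡ = trans (cong (λ σ → lo ℤ.+ + suc k ℤ.* σ) σ≡len)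
                 (trans (identity lo (+ k) (+ len)) (cong (ℤ._+_ lo′) (sym (ℤ.pos-* k len))))

  copies-coords-down : ∀ {K A lo len} → proj₂ (βpow L K) ≡ - + len → coords A ↭ range lo len →
                       ∀ k → coords (copies K A k) ↭ range (lo ℤ.- + (k ℕ.* len)) (k ℕ.* len)
  copies-coords-down σ≡-len A↭ zero = ↭-reflexive refl
  copies-coords-down {K} {A} {lo} {len} σ≡-len A↭ (suc k) = begin
    coords (copies K A (suc k))                         ≡⟨ coords-copies-suc K A k ⟩
    coords (copies K A k) ++ coords (column K A k)      ↭⟨ ++⁺ (copies-coords-down {K} σ≡-len A↭ k) (column-coords {K} k A↭) ⟩
    range old (k ℕ.* len) ++ range new len              ↭⟨ ++-comm (range old (k ℕ.* len)) (range new len) ⟩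
    range new len ++ range old (k ℕ.* len)              ≡⟨ cong₂ (λ l l′ → range l len ++ range l′ (k ℕ.* len)) new≡ old≡ ⟩
    range lo′ len ++ range (lo′ ℤ.+ + len) (k ℕ.* len)  ≡⟨ sym (range-++ lo′ len (k ℕ.* len)) ⟩
    range lo′ (suc k ℕ.* len)                           ∎
    where
    open PermutationReasoning
    lo′ = lo ℤ.- + (suc k ℕ.* len)
    old = lo ℤ.- + (k ℕ.* len)
    new = lo ℤ.+ + suc k ℤ.* proj₂ (βpow L K)
    +[suc-k*len] : + (suc k ℕ.* len) ≡ + len ℤ.+ + k ℤ.* + len
    +[suc-k*len] = trans (ℤ.pos-+ len (k ℕ.* len)) (cong (ℤ._+_ (+ len)) (ℤ.pos-* k len))
    identity₁ : ∀ lo k n → lo ℤ.+ (+ 1 ℤ.+ k) ℤ.* (- n) ≡ lo ℤ.- (n ℤ.+ k ℤ.* n)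
    identity₁ = solve-∀
    identity₂ : ∀ lo k n → lo ℤ.- k ℤ.* n ≡ (lo ℤ.- (n ℤ.+ k ℤ.* n)) ℤ.+ n
    identity₂ = solve-∀
    new≡ : new ≡ lo′
    new≡ = trans (cong (λ σ → lo ℤ.+ + suc k ℤ.* σ) σ≡-len)
                 (trans (identity₁ lo (+ k) (+ len)) (cong (ℤ._-_ lo) (sym +[suc-k*len])))
    old≡ : old ≡ lo′ ℤ.+ + len
    old≡ = trans (cong (ℤ._-_ lo) (ℤ.pos-* k len))
                 (trans (identity₂ lo (+ k) (+ len)) (cong (λ t → (lo ℤ.- t) ℤ.+ + len) (sym +[suc-k*len])))

  -- Λ^(n+1) = A ++ R, where A and R are the left endpoints of the intervals of length β^(n+1)
  -- and β^(n+2) of the paper's partition; the β-coordinates of each form a range of integers.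
  record Layout (n : ℕ) (loA loR : ℤ) : Set where
    field
      A R : List Zβ
      split : Λ' L n ≡ A ++ R
      coords-A : coords A ↭ range loA (qq L (3 ℕ.+ n))
      coords-R : coords R ↭ range loR (qq L (2 ℕ.+ n))
      fits-A : ∀ {x} → x ∈ A → Fits x (βpow L (suc n))
      fits-R : ∀ {x} → x ∈ R → Fits x (βpow L (2 ℕ.+ n))

  LayoutEven : ℕ → Set
  LayoutEven n = Layout n (- + qq L (2 ℕ.+ n)) (- + qq L (2 ℕ.+ n) ℤ.+ + qq L (3 ℕ.+ n))

  LayoutOdd : ℕ → Set
  LayoutOdd n = Layout n (- + qq L (3 ℕ.+ n) ℤ.+ + qq L (2 ℕ.+ n)) (- + qq L (3 ℕ.+ n))

  qq-2 : qq L 2 ≡ 1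
  qq-2 = cong (ℕ._+ 1) (ℕ.*-zeroʳ L)

  qq-3 : qq L 3 ≡ L
  qq-3 = trans (ℕ.+-identityʳ (L ℕ.* qq L 2)) (trans (cong (L ℕ.*_) qq-2) (ℕ.*-identityʳ L))

  lseq≡qq : ∀ k → lseq L k ≡ qq L (2 ℕ.+ k)
  lseq≡qq zero = sym qq-2
  lseq≡qq (suc zero) = sym qq-3
  lseq≡qq (suc (suc k)) = cong₂ (λ a b → L ℕ.* a ℕ.+ b) (lseq≡qq (suc k)) (lseq≡qq k)

  module Growth {n loA loR} (P : Layout n loA loR) where

    open Layout P public

    K : ℕ
    K = 2 ℕ.+ n

    length-A : length A ≡ qq L (3 ℕ.+ n)
    length-A = trans (sym (List.length-map proj₂ A)) (trans (↭-length coords-A) (length-range loA _))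

    Λ′-suc : Λ' L (suc n) ≡ Λ' L n ++ copies K A L
    Λ′-suc = cong (λ T → Λ' L n ++ copies K T L)
                  (trans (cong₂ take (trans (lseq≡qq (suc n)) (sym length-A)) split) (take-length-++ A R))

    A′ : List Zβ
    A′ = A ++ (R ++ copies K A ℓ)

    R′ : List Zβ
    R′ = column K A ℓ

    split′ : Λ' L (suc n) ≡ A′ ++ R′
    split′ = begin
      Λ' L (suc n)                            ≡⟨ Λ′-suc ⟩
      Λ' L n ++ copies K A L                  ≡⟨ cong₂ _++_ split (copies-suc K A ℓ) ⟩
      (A ++ R) ++ (copies K A ℓ ++ R′)        ≡⟨ List.++-assoc A R _ ⟩
      A ++ (R ++ (copies K A ℓ ++ R′))        ≡⟨ cong (A ++_) (sym (List.++-assoc R (copies K A ℓ) R′)) ⟩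
      A ++ ((R ++ copies K A ℓ) ++ R′)        ≡⟨ sym (List.++-assoc A (R ++ copies K A ℓ) R′) ⟩
      A′ ++ R′                                ∎
      where open ≡-Reasoning

    coords-A′≡ : coords A′ ≡ coords A ++ (coords R ++ coords (copies K A ℓ))
    coords-A′≡ = trans (List.map-++ proj₂ A (R ++ copies K A ℓ)) (cong (coords A ++_) (List.map-++ proj₂ R (copies K A ℓ)))

    fits-A′ : ∀ {x} → x ∈ A′ → Fits x (βpow L K)
    fits-A′ x∈ with ∈-++⁻ A x∈
    ... | inj₁ x∈A = fits-shrink (suc n) (fits-A x∈A)
    ... | inj₂ x∈ with ∈-++⁻ R x∈
    ...   | inj₁ x∈R = fits-R x∈R
    ...   | inj₂ x∈copies with ∈-copies⁻ {K} {A} {ℓ} x∈copies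
    ...     | i , i<ℓ , ξ , ξ∈A , refl = fits-column n i<ℓ (fits-A ξ∈A)

    fits-R′ : ∀ {x} → x ∈ R′ → Fits x (βpow L (suc K))
    fits-R′ x∈ with ∈-map⁻ (ψ L K L) x∈
    ... | ξ , ξ∈A , refl = fits-last-column n (fits-A ξ∈A)

  step-even : ∀ {n} → proj₂ (βpow L (2 ℕ.+ n)) ≡ - + qq L (3 ℕ.+ n) → LayoutEven n → LayoutOdd (suc n)
  step-even {n} σ≡ P = record
    { A = A′ ; R = R′ ; split = split′ ; fits-A = fits-A′ ; fits-R = fits-R′
    ; coords-A = coords-A′ ; coords-R = coords-R′ }
    where
    open Growth P
    q₂ = qq L (2 ℕ.+ n)
    q₃ = qq L (3 ℕ.+ n)
    lo = - + q₂
    m = ℓ ℕ.* q₃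
    C = copies K A ℓ
    lo′ = lo ℤ.- + m
    lo′≡ : lo′ ≡ - + qq L (4 ℕ.+ n) ℤ.+ + q₃
    lo′≡ = trans (cong (ℤ._-_ lo) (ℤ.pos-* ℓ q₃))
             (trans (identity (+ ℓ) (+ q₂) (+ q₃)) (cong (λ t → - t ℤ.+ + q₃) (sym (+qq-rec L (2 ℕ.+ n)))))
      where
      identity : ∀ l q₂ q₃ → - q₂ ℤ.- l ℤ.* q₃ ≡ - ((+ 1 ℤ.+ l) ℤ.* q₃ ℤ.+ q₂) ℤ.+ q₃
      identity = solve-∀
    lo≡ : lo ≡ lo′ ℤ.+ + m
    lo≡ = identity lo (+ m)
      where
      identity : ∀ lo t → lo ≡ (lo ℤ.- t) ℤ.+ t
      identity = solve-∀
    coords-A′ : coords A′ ↭ range (- + qq L (4 ℕ.+ n) ℤ.+ + q₃) (qq L (4 ℕ.+ n))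
    coords-A′ = begin
      coords A′                                              ≡⟨ coords-A′≡ ⟩
      coords A ++ (coords R ++ coords C)                     ↭⟨ ++⁺ coords-A (++⁺ coords-R (copies-coords-down {K} σ≡ coords-A ℓ)) ⟩
      range lo q₃ ++ (range (lo ℤ.+ + q₃) q₂ ++ range lo′ m) ≡⟨ sym (List.++-assoc (range lo q₃) _ _) ⟩
      (range lo q₃ ++ range (lo ℤ.+ + q₃) q₂) ++ range lo′ m ≡⟨ cong (_++ range lo′ m) (sym (range-++ lo q₃ q₂)) ⟩
      range lo (q₃ ℕ.+ q₂) ++ range lo′ m                    ↭⟨ ++-comm (range lo (q₃ ℕ.+ q₂)) (range lo′ m) ⟩
      range lo′ m ++ range lo (q₃ ℕ.+ q₂)                    ≡⟨ cong (λ l → range lo′ m ++ range l (q₃ ℕ.+ q₂)) lo≡ ⟩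
      range lo′ m ++ range (lo′ ℤ.+ + m) (q₃ ℕ.+ q₂)         ≡⟨ sym (range-++ lo′ m (q₃ ℕ.+ q₂)) ⟩
      range lo′ (m ℕ.+ (q₃ ℕ.+ q₂))                          ≡⟨ cong₂ range lo′≡ (lengths ℓ q₃ q₂) ⟩
      range (- + qq L (4 ℕ.+ n) ℤ.+ + q₃) (qq L (4 ℕ.+ n))   ∎
      where
      open PermutationReasoning
      lengths : ∀ l q₃ q₂ → l ℕ.* q₃ ℕ.+ (q₃ ℕ.+ q₂) ≡ (q₃ ℕ.+ l ℕ.* q₃) ℕ.+ q₂
      lengths = ℕ-Solver.solve-∀
    coords-R′ : coords R′ ↭ range (- + qq L (4 ℕ.+ n)) q₃
    coords-R′ = ↭-trans (column-coords {K} ℓ coords-A) (↭-reflexive (cong (λ l → range l q₃) shift))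
      where
      identity : ∀ l q₂ q₃ → - q₂ ℤ.+ (+ 1 ℤ.+ l) ℤ.* (- q₃) ≡ - ((+ 1 ℤ.+ l) ℤ.* q₃ ℤ.+ q₂)
      identity = solve-∀
      shift : lo ℤ.+ + L ℤ.* proj₂ (βpow L K) ≡ - + qq L (4 ℕ.+ n)
      shift = trans (cong (λ σ → lo ℤ.+ + L ℤ.* σ) σ≡)
                (trans (identity (+ ℓ) (+ q₂) (+ q₃)) (cong -_ (sym (+qq-rec L (2 ℕ.+ n)))))

  step-odd : ∀ {n} → proj₂ (βpow L (2 ℕ.+ n)) ≡ + qq L (3 ℕ.+ n) → LayoutOdd n → LayoutEven (suc n)
  step-odd {n} σ≡ P = record
    { A = A′ ; R = R′ ; split = split′ ; fits-A = fits-A′ ; fits-R = fits-R′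
    ; coords-A = coords-A′ ; coords-R = coords-R′ }
    where
    open Growth P
    q₂ = qq L (2 ℕ.+ n)
    q₃ = qq L (3 ℕ.+ n)
    lo = - + q₃
    loA = lo ℤ.+ + q₂
    m = ℓ ℕ.* q₃
    C = copies K A ℓ
    coords-A′ : coords A′ ↭ range lo (qq L (4 ℕ.+ n))
    coords-A′ = begin
      coords A′                                               ≡⟨ coords-A′≡ ⟩
      coords A ++ (coords R ++ coords C)                      ↭⟨ ++⁺ coords-A (++⁺ coords-R (copies-coords-up {K} σ≡ coords-A ℓ)) ⟩
      range loA q₃ ++ (range lo q₂ ++ range (loA ℤ.+ + q₃) m) ↭⟨ shifts (range loA q₃) (range lo q₂) ⟩
      range lo q₂ ++ (range loA q₃ ++ range (loA ℤ.+ + q₃) m) ≡⟨ cong (range lo q₂ ++_) (sym (range-++ loA q₃ m)) ⟩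
      range lo q₂ ++ range loA (q₃ ℕ.+ m)                     ≡⟨ sym (range-++ lo q₂ (q₃ ℕ.+ m)) ⟩
      range lo (q₂ ℕ.+ (q₃ ℕ.+ m))                            ≡⟨ cong (range lo) (ℕ.+-comm q₂ (q₃ ℕ.+ m)) ⟩
      range lo (qq L (4 ℕ.+ n))                               ∎
      where open PermutationReasoning
    coords-R′ : coords R′ ↭ range (lo ℤ.+ + qq L (4 ℕ.+ n)) q₃
    coords-R′ = ↭-trans (column-coords {K} ℓ coords-A) (↭-reflexive (cong (λ l → range l q₃) shift))
      where
      identity : ∀ l q₂ q₃ → (- q₃ ℤ.+ q₂) ℤ.+ (+ 1 ℤ.+ l) ℤ.* q₃ ≡ - q₃ ℤ.+ ((+ 1 ℤ.+ l) ℤ.* q₃ ℤ.+ q₂)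
      identity = solve-∀
      shift : (lo ℤ.+ + q₂) ℤ.+ + L ℤ.* proj₂ (βpow L K) ≡ lo ℤ.+ + qq L (4 ℕ.+ n)
      shift = trans (cong (λ σ → (lo ℤ.+ + q₂) ℤ.+ + L ℤ.* σ) σ≡)
                (trans (identity (+ ℓ) (+ q₂) (+ q₃)) (cong (ℤ._+_ lo) (sym (+qq-rec L (2 ℕ.+ n)))))

  point : ℕ → Zβ
  point i = scal (+ i) βelt

  coords-points : ∀ (f : ℕ → ℕ) n → coords (map point (applyUpTo f n)) ≡ applyUpTo (λ i → + f i ℤ.* + 1) n
  coords-points f n = trans (sym (List.map-∘ (applyUpTo f n))) (List.map-applyUpTo f (λ x → proj₂ (point x)) n)

  zero≼point : ∀ i → zeroβ ≼ point i
  zero≼point i = scal-nonNeg i (subst (zeroβ ≼_) (βpow-one L) (zero≼βpow 1))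

  base : LayoutEven 0
  base = record
    { A = map point (upTo L) ; R = point L ∷ []
    ; split = trans (cong (map point) (sym (List.upTo-∷ʳ L))) (List.map-++ point (upTo L) (L ∷ []))
    ; coords-A = ↭-reflexive coords-A
    ; coords-R = ↭-reflexive coords-R
    ; fits-A = fits-A
    ; fits-R = λ { (here refl) → zero≼point L , ≼-reflexive fits-R } }
    where
    coords-A : coords (map point (upTo L)) ≡ range (- + qq L 2) (qq L 3)
    coords-A = begin
      coords (map point (upTo L))                 ≡⟨ coords-points (λ i → i) L ⟩
      applyUpTo (λ i → + i ℤ.* + 1) L             ≡⟨ applyUpTo-cong L (λ i _ → sym (identity (+ i))) ⟩
      applyUpTo (λ i → - + 1 ℤ.+ + suc i) L       ≡⟨ sym (range-applyUpTo (- + 1) L) ⟩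
      range (- + 1) L                             ≡⟨ sym (cong₂ (λ a b → range (- + a) b) qq-2 qq-3) ⟩
      range (- + qq L 2) (qq L 3)                 ∎
      where
      open ≡-Reasoning
      identity : ∀ i → - + 1 ℤ.+ (+ 1 ℤ.+ i) ≡ i ℤ.* + 1
      identity = solve-∀
    coords-R : coords (point L ∷ []) ≡ range (- + qq L 2 ℤ.+ + qq L 3) (qq L 2)
    coords-R = trans (cong (_∷ []) (identity (+ L))) (sym (cong₂ (λ a b → range (- + a ℤ.+ + b) a) qq-2 qq-3))
      where
      identity : ∀ l → l ℤ.* + 1 ≡ + 1 ℤ.+ (- + 1 ℤ.+ l)
      identity = solve-∀
    fits-A : ∀ {x} → x ∈ map point (upTo L) → Fits x (βpow L 1)
    fits-A x∈ with ∈-map⁻ point x∈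
    ... | i , i∈ , refl = zero≼point i , subst (_≼ oneβ) regroup (scal-βpow-≼ 0 (∈-upTo⁻ i∈))
      where
      regroup : scal (+ suc i) (βpow L 1) ≡ point i ⊕ βpow L 1
      regroup = trans (scal-suc i (βpow L 1)) (cong (λ b → scal (+ i) b ⊕ βpow L 1) (βpow-one L))
    fits-R : point L ⊕ βpow L 2 ≡ oneβ
    fits-R = sym (trans (βpow-unfold L 0) (cong (λ b → scal (+ L) b ⊕ βpow L 2) (βpow-one L)))

  βpow-coord-even : ∀ j → proj₂ (βpow L (2 ℕ.+ (j ℕ.+ j))) ≡ - + qq L (3 ℕ.+ (j ℕ.+ j))
  βpow-coord-even j = subst (λ n → proj₂ (βpow L n) ≡ - + qq L (suc n)) (cong suc (ℕ.+-suc j j)) (cong proj₂ (βpow-even L (suc j)))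

  βpow-coord-odd : ∀ j → proj₂ (βpow L (3 ℕ.+ (j ℕ.+ j))) ≡ + qq L (4 ℕ.+ (j ℕ.+ j))
  βpow-coord-odd j = subst (λ n → proj₂ (βpow L (suc n)) ≡ + qq L (suc (suc n))) (cong suc (ℕ.+-suc j j)) (cong proj₂ (βpow-odd L (suc j)))

  layouts : ∀ j → LayoutEven (j ℕ.+ j) × LayoutOdd (suc (j ℕ.+ j))
  layouts zero = base , step-even (βpow-coord-even 0) base
  layouts (suc j) = even , step-even (βpow-coord-even (suc j)) even
    where
    even : LayoutEven (suc j ℕ.+ suc j)
    even = subst LayoutEven (cong suc (sym (ℕ.+-suc j j))) (step-odd (βpow-coord-odd j) (proj₂ (layouts j)))

  parity-split : ∀ n → Σ ℕ λ j → n ≡ j ℕ.+ j ⊎ n ≡ suc (j ℕ.+ j)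
  parity-split zero = 0 , inj₁ refl
  parity-split (suc n) with parity-split n
  ... | j , inj₁ refl = j , inj₂ refl
  ... | j , inj₂ refl = suc j , inj₁ (cong suc (sym (ℕ.+-suc j j)))

  layout : ∀ n → Σ ℤ λ loA → Σ ℤ λ loR → Layout n loA loR
  layout n with parity-split n
  ... | j , inj₁ refl = _ , _ , proj₁ (layouts j)
  ... | j , inj₂ refl = _ , _ , proj₂ (layouts j)

  length-Λ′-0 : length (Λ' L 0) ≡ suc L
  length-Λ′-0 = trans (List.length-map point (upTo (suc L))) (List.length-upTo (suc L))

  length-Λ′-suc : ∀ n → length (Λ' L (suc n)) ≡ length (Λ' L n) ℕ.+ L ℕ.* qq L (3 ℕ.+ n)
  length-Λ′-suc n with layout n
  ... | _ , _ , P = begin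
    length (Λ' L (suc n))                          ≡⟨ cong length Λ′-suc ⟩
    length (Λ' L n ++ copies K A L)                ≡⟨ List.length-++ (Λ' L n) ⟩
    length (Λ' L n) ℕ.+ length (copies K A L)      ≡⟨ cong (length (Λ' L n) ℕ.+_) (length-copies K A L) ⟩
    length (Λ' L n) ℕ.+ L ℕ.* length A             ≡⟨ cong (λ a → length (Λ' L n) ℕ.+ L ℕ.* a) length-A ⟩
    length (Λ' L n) ℕ.+ L ℕ.* qq L (3 ℕ.+ n)       ∎
    where
    open Growth P
    open ≡-Reasoning

  length-Λ′ : ∀ m → suc m ℕ.≤ length (Λ' L m)
  length-Λ′ zero = subst (1 ℕ.≤_) (sym length-Λ′-0) (s≤s z≤n)
  length-Λ′ (suc m) = begin
    suc (suc m)                                    ≡⟨ ℕ.+-comm 1 (suc m) ⟩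
    suc m ℕ.+ 1                                    ≤⟨ ℕ.+-mono-≤ (length-Λ′ m) (ℕ.*-mono-≤ {1} {L} (s≤s z≤n) (qq-pos (suc m))) ⟩
    length (Λ' L m) ℕ.+ L ℕ.* qq L (3 ℕ.+ m)       ≡⟨ sym (length-Λ′-suc m) ⟩
    length (Λ' L (suc m))                          ∎
    where open ℕ.≤-Reasoning

  blockStart-Λ′ : ∀ n → blockStart L (3 ℕ.+ n) ≡ suc (length (Λ' L n))
  blockStart-Λ′ zero = cong (2 ℕ.+_) (trans (trans (cong (L ℕ.*_) qq-2) (ℕ.*-identityʳ L)) (sym (ℕ.suc-injective length-Λ′-0)))
  blockStart-Λ′ (suc n) = trans (cong (ℕ._+ L ℕ.* qq L (3 ℕ.+ n)) (blockStart-Λ′ n)) (cong suc (sym (length-Λ′-suc n)))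

  Λ′-prefix : ∀ a d → Σ (List Zβ) λ rest → Λ' L (d ℕ.+ a) ≡ Λ' L a ++ rest
  Λ′-prefix a zero = [] , sym (List.++-identityʳ (Λ' L a))
  Λ′-prefix a (suc d) with Λ′-prefix a d
  ... | rest , split = rest ++ new , trans (cong (_++ new) split) (List.++-assoc (Λ' L a) rest new)
    where
    new = copies (2 ℕ.+ (d ℕ.+ a)) (take (lseq L (suc (d ℕ.+ a))) (Λ' L (d ℕ.+ a))) L

  nth-++ˡ : ∀ xs ys {i} → i ℕ.< length xs → nth (xs ++ ys) i ≡ nth xs i
  nth-++ˡ (x ∷ xs) ys {zero} _ = refl
  nth-++ˡ (x ∷ xs) ys {suc i} (s≤s i<) = nth-++ˡ xs ys i<

  nth-++ʳ : ∀ xs ys j → nth (xs ++ ys) (length xs ℕ.+ j) ≡ nth ys j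
  nth-++ʳ [] ys j = refl
  nth-++ʳ (x ∷ xs) ys j = nth-++ʳ xs ys j

  applyUpTo-nth : ∀ xs → applyUpTo (nth xs) (length xs) ≡ xs
  applyUpTo-nth [] = refl
  applyUpTo-nth (x ∷ xs) = cong (x ∷_) (applyUpTo-nth xs)

  nth-Λ′-mono : ∀ {a b i} → a ℕ.≤ b → i ℕ.< length (Λ' L a) → nth (Λ' L b) i ≡ nth (Λ' L a) i
  nth-Λ′-mono {a} {b} {i} a≤b i< with Λ′-prefix a (b ℕ.∸ a)
  ... | rest , split = begin
    nth (Λ' L b) i                   ≡⟨ cong (λ m → nth (Λ' L m) i) (sym (ℕ.m∸n+n≡m a≤b)) ⟩
    nth (Λ' L (b ℕ.∸ a ℕ.+ a)) i     ≡⟨ cong (λ xs → nth xs i) split ⟩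
    nth (Λ' L a ++ rest) i           ≡⟨ nth-++ˡ (Λ' L a) rest i< ⟩
    nth (Λ' L a) i                   ∎
    where open ≡-Reasoning

  ξ≡nth-Λ′ : ∀ N {i} → i ℕ.< length (Λ' L N) → ξ L (suc i) ≡ nth (Λ' L N) i
  ξ≡nth-Λ′ N {i} i< with ℕ.≤-total (suc i) N
  ... | inj₁ i<N = sym (nth-Λ′-mono i<N (ℕ.≤-trans (ℕ.n≤1+n (suc i)) (length-Λ′ (suc i))))
  ... | inj₂ N≤i = nth-Λ′-mono N≤i i<

  block≡ : ∀ b N P T → Λ' L N ≡ P ++ T → blockStart L b ≡ suc (length P) → blockSize L b ≡ length T →
           block L b ≡ T
  block≡ b N P T split start size = begin
    block L b                                                   ≡⟨ List.map-upTo _ (blockSize L b) ⟩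
    applyUpTo (λ j → ξ L (blockStart L b ℕ.+ j)) (blockSize L b) ≡⟨ cong₂ (λ s n → applyUpTo (λ j → ξ L (s ℕ.+ j)) n) start size ⟩
    applyUpTo (λ j → ξ L (suc (length P ℕ.+ j))) (length T)     ≡⟨ applyUpTo-cong (length T) entry ⟩
    applyUpTo (nth T) (length T)                                ≡⟨ applyUpTo-nth T ⟩
    T                                                           ∎
    where
    open ≡-Reasoning
    entry : ∀ j → j ℕ.< length T → ξ L (suc (length P ℕ.+ j)) ≡ nth T j
    entry j j< = begin
      ξ L (suc (length P ℕ.+ j))         ≡⟨ ξ≡nth-Λ′ N (subst (λ xs → length P ℕ.+ j ℕ.< length xs) (sym split) bound) ⟩
      nth (Λ' L N) (length P ℕ.+ j)      ≡⟨ cong (λ xs → nth xs (length P ℕ.+ j)) split ⟩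
      nth (P ++ T) (length P ℕ.+ j)      ≡⟨ nth-++ʳ P T j ⟩
      nth T j                            ∎
      where
      bound : length P ℕ.+ j ℕ.< length (P ++ T)
      bound = subst (length P ℕ.+ j ℕ.<_) (sym (List.length-++ P)) (ℕ.+-monoʳ-< (length P) j<)

  Λ′-unit : ∀ n {x} → x ∈ Λ' L n → zeroβ ≤[ L ] x × x <[ L ] oneβ
  Λ′-unit n x∈ with layout n
  ... | _ , _ , P with ∈-++⁻ (Layout.A P) (subst (_ ∈_) (Layout.split P) x∈)
  ...   | inj₁ x∈A = fits⇒unit (suc n) (Layout.fits-A P x∈A)
  ...   | inj₂ x∈R = fits⇒unit (2 ℕ.+ n) (Layout.fits-R P x∈R)

  IsFrac-intro : ∀ {c x} → proj₂ x ≡ c → zeroβ ≤[ L ] x → x <[ L ] oneβ → IsFrac L (scal c βelt) x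
  IsFrac-intro {c} {a , b} refl 0≤x x<1 = (a , cong₂ _,_ (identity₁ b a) (identity₂ b)) , 0≤x , x<1
    where
    identity₁ : ∀ c a → a ≡ c ℤ.* + 0 ℤ.+ a
    identity₁ = solve-∀
    identity₂ : ∀ c → c ≡ c ℤ.* + 1 ℤ.+ + 0
    identity₂ = solve-∀

  BlockPos : ℕ → ℕ → ℕ → Set
  BlockPos b a c =
    (∀ x → x ∈ block L b → Σ ℕ λ m → a ℕ.+ 1 ℕ.≤ m × m ℕ.≤ c × IsFrac L (scal (+ m) βelt) x)
    × (∀ m → a ℕ.+ 1 ℕ.≤ m → m ℕ.≤ c → Σ Zβ λ x → x ∈ block L b × IsFrac L (scal (+ m) βelt) x)

  BlockNeg : ℕ → ℕ → ℕ → Set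
  BlockNeg b a c =
    (∀ x → x ∈ block L b → Σ ℕ λ m → a ℕ.≤ m × m ℕ.≤ c ℕ.∸ 1 × IsFrac L (scal (- (+ m)) βelt) x)
    × (∀ m → a ℕ.≤ m → m ℕ.≤ c ℕ.∸ 1 → Σ Zβ λ x → x ∈ block L b × IsFrac L (scal (- (+ m)) βelt) x)

  ∈-coords-range : ∀ {xs lo len x} → coords xs ↭ range lo len → x ∈ xs → lo ℤ.< proj₂ x × proj₂ x ℤ.≤ lo ℤ.+ + len
  ∈-coords-range {lo = lo} {len} xs↭ x∈ = ∈-range⁻ lo len (∈-resp-↭ xs↭ (∈-map⁺ proj₂ x∈))

  coords-range-∈ : ∀ {xs lo len z} → coords xs ↭ range lo len → lo ℤ.< z → z ℤ.≤ lo ℤ.+ + len →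
                   Σ Zβ λ x → x ∈ xs × proj₂ x ≡ z
  coords-range-∈ {lo = lo} {len} xs↭ lo<z z≤ with ∈-map⁻ proj₂ (∈-resp-↭ (↭-sym xs↭) (∈-range⁺ lo len lo<z z≤))
  ... | x , x∈ , z≡ = x , x∈ , sym z≡

  IsFrac-in-Λ′ : ∀ N {c x} → x ∈ Λ' L N → proj₂ x ≡ c → IsFrac L (scal c βelt) x
  IsFrac-in-Λ′ N x∈ x≡c = IsFrac-intro x≡c (proj₁ (Λ′-unit N x∈)) (proj₂ (Λ′-unit N x∈))

  block-pos : ∀ b {a c len} N → block L b ⊆ Λ' L N → coords (block L b) ↭ range (+ a) len →
              + a ℤ.+ + len ≡ + c → BlockPos b a c
  block-pos b {a} {c} {len} N ⊆Λ′ block↭ top = members , cover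
    where
    members : ∀ x → x ∈ block L b → Σ ℕ λ m → a ℕ.+ 1 ℕ.≤ m × m ℕ.≤ c × IsFrac L (scal (+ m) βelt) x
    members x x∈ with ∈-coords-range block↭ x∈
    ... | a<x , x≤ with pos-window⁻ a<x (subst (proj₂ x ℤ.≤_) top x≤)
    ...   | m , a+1≤m , m≤c , x≡m = m , a+1≤m , m≤c , IsFrac-in-Λ′ N (⊆Λ′ x∈) x≡m
    cover : ∀ m → a ℕ.+ 1 ℕ.≤ m → m ℕ.≤ c → Σ Zβ λ x → x ∈ block L b × IsFrac L (scal (+ m) βelt) x
    cover m a+1≤m m≤c with pos-window⁺ a+1≤m m≤c
    ... | a<m , m≤c′ with coords-range-∈ block↭ a<m (subst (+ m ℤ.≤_) (sym top) m≤c′)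
    ...   | x , x∈ , x≡m = x , x∈ , IsFrac-in-Λ′ N (⊆Λ′ x∈) x≡m

  block-neg : ∀ b {a c len} N → 1 ℕ.≤ c → block L b ⊆ Λ' L N → coords (block L b) ↭ range (- + c) len →
              - + c ℤ.+ + len ≡ - + a → BlockNeg b a c
  block-neg b {a} {c} {len} N 1≤c ⊆Λ′ block↭ top = members , cover
    where
    members : ∀ x → x ∈ block L b → Σ ℕ λ m → a ℕ.≤ m × m ℕ.≤ c ℕ.∸ 1 × IsFrac L (scal (- (+ m)) βelt) x
    members x x∈ with ∈-coords-range block↭ x∈
    ... | -c<x , x≤ with neg-window⁻ -c<x (subst (proj₂ x ℤ.≤_) top x≤)
    ...   | m , a≤m , m≤c-1 , x≡-m = m , a≤m , m≤c-1 , IsFrac-in-Λ′ N (⊆Λ′ x∈) x≡-m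
    cover : ∀ m → a ℕ.≤ m → m ℕ.≤ c ℕ.∸ 1 → Σ Zβ λ x → x ∈ block L b × IsFrac L (scal (- (+ m)) βelt) x
    cover m a≤m m≤c-1 with neg-window⁺ 1≤c a≤m m≤c-1
    ... | -c<-m , -m≤-a with coords-range-∈ block↭ -c<-m (subst (- + m ℤ.≤_) (sym top) -m≤-a)
    ...   | x , x∈ , x≡-m = x , x∈ , IsFrac-in-Λ′ N (⊆Λ′ x∈) x≡-m

  module NewBlock {n loA loR} (P : Layout n loA loR) where

    open Growth P public

    block≡copies : block L (3 ℕ.+ n) ≡ copies K A L
    block≡copies = block≡ (3 ℕ.+ n) (suc n) (Λ' L n) (copies K A L) Λ′-suc (blockStart-Λ′ n)
                          (sym (trans (length-copies K A L) (cong (L ℕ.*_) length-A)))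

    block⊆Λ′ : block L (3 ℕ.+ n) ⊆ Λ' L (suc n)
    block⊆Λ′ {x} x∈ = subst (x ∈_) (sym Λ′-suc) (∈-++⁺ʳ (Λ' L n) (subst (x ∈_) block≡copies x∈))

  block-odd : ∀ j → BlockNeg (3 ℕ.+ (j ℕ.+ j)) (qq L (2 ℕ.+ (j ℕ.+ j))) (qq L (4 ℕ.+ (j ℕ.+ j)))
  block-odd j = block-neg (3 ℕ.+ (j ℕ.+ j)) (suc (j ℕ.+ j)) (qq-pos (2 ℕ.+ n)) block⊆Λ′ coords-block top
    where
    n = j ℕ.+ j
    open NewBlock (proj₁ (layouts j))
    q₂ = qq L (2 ℕ.+ n)
    q₃ = qq L (3 ℕ.+ n)
    +qq-4 : + qq L (4 ℕ.+ n) ≡ + (L ℕ.* q₃) ℤ.+ + q₂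
    +qq-4 = ℤ.pos-+ (L ℕ.* q₃) q₂
    bottom : - + q₂ ℤ.- + (L ℕ.* q₃) ≡ - + qq L (4 ℕ.+ n)
    bottom = trans (identity (+ q₂) (+ (L ℕ.* q₃))) (cong -_ (sym +qq-4))
      where
      identity : ∀ a b → - a ℤ.- b ≡ - (b ℤ.+ a)
      identity = solve-∀
    top : - + qq L (4 ℕ.+ n) ℤ.+ + (L ℕ.* q₃) ≡ - + q₂
    top = trans (cong (λ t → - t ℤ.+ + (L ℕ.* q₃)) +qq-4) (identity (+ q₂) (+ (L ℕ.* q₃)))
      where
      identity : ∀ a b → - (b ℤ.+ a) ℤ.+ b ≡ - a
      identity = solve-∀
    coords-block : coords (block L (3 ℕ.+ n)) ↭ range (- + qq L (4 ℕ.+ n)) (L ℕ.* q₃)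
    coords-block = begin
      coords (block L (3 ℕ.+ n))               ≡⟨ cong coords block≡copies ⟩
      coords (copies K A L)                    ↭⟨ copies-coords-down {K} (βpow-coord-even j) coords-A L ⟩
      range (- + q₂ ℤ.- + (L ℕ.* q₃)) (L ℕ.* q₃) ≡⟨ cong (λ l → range l (L ℕ.* q₃)) bottom ⟩
      range (- + qq L (4 ℕ.+ n)) (L ℕ.* q₃)    ∎
      where open PermutationReasoning

  block-even : ∀ j → BlockPos (4 ℕ.+ (j ℕ.+ j)) (qq L (3 ℕ.+ (j ℕ.+ j))) (qq L (5 ℕ.+ (j ℕ.+ j)))
  block-even j = block-pos (4 ℕ.+ (j ℕ.+ j)) (suc (suc (j ℕ.+ j))) block⊆Λ′ coords-block top
    where
    n = suc (j ℕ.+ j)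
    open NewBlock (proj₂ (layouts j))
    q₂ = qq L (2 ℕ.+ n)
    q₃ = qq L (3 ℕ.+ n)
    bottom : - + q₃ ℤ.+ + q₂ ℤ.+ + q₃ ≡ + q₂
    bottom = identity (+ q₂) (+ q₃)
      where
      identity : ∀ a b → - b ℤ.+ a ℤ.+ b ≡ a
      identity = solve-∀
    top : + q₂ ℤ.+ + (L ℕ.* q₃) ≡ + qq L (4 ℕ.+ n)
    top = trans (ℤ.+-comm (+ q₂) (+ (L ℕ.* q₃))) (sym (ℤ.pos-+ (L ℕ.* q₃) q₂))
    coords-block : coords (block L (3 ℕ.+ n)) ↭ range (+ q₂) (L ℕ.* q₃)
    coords-block = begin
      coords (block L (3 ℕ.+ n))               ≡⟨ cong coords block≡copies ⟩
      coords (copies K A L)                    ↭⟨ copies-coords-up {K} (βpow-coord-odd j) coords-A L ⟩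
      range (- + q₃ ℤ.+ + q₂ ℤ.+ + q₃) (L ℕ.* q₃) ≡⟨ cong (λ l → range l (L ℕ.* q₃)) bottom ⟩
      range (+ q₂) (L ℕ.* q₃)                  ∎
      where open PermutationReasoning

  block-two : BlockPos 2 (qq L 1) (qq L 3)
  block-two = block-pos 2 0 block⊆Λ′ (↭-reflexive coords-block) (cong +_ (sym qq-3))
    where
    T = map point (applyUpTo suc L)
    block≡T : block L 2 ≡ T
    block≡T = block≡ 2 0 (point 0 ∷ []) T refl refl (trans (cong (L ℕ.*_) qq-2) (trans (ℕ.*-identityʳ L) (sym length-T)))
      where
      length-T : length T ≡ L
      length-T = trans (List.length-map point (applyUpTo suc L)) (List.length-applyUpTo suc L)
    block⊆Λ′ : block L 2 ⊆ Λ' L 0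
    block⊆Λ′ {x} x∈ = there (subst (x ∈_) block≡T x∈)
    coords-block : coords (block L 2) ≡ range (+ 0) L
    coords-block = begin
      coords (block L 2)                          ≡⟨ cong coords block≡T ⟩
      coords T                                    ≡⟨ coords-points suc L ⟩
      applyUpTo (λ i → + suc i ℤ.* + 1) L         ≡⟨ applyUpTo-cong L (λ i _ → ℤ.*-identityʳ (+ suc i)) ⟩
      applyUpTo (λ i → + 0 ℤ.+ + suc i) L         ≡⟨ sym (range-applyUpTo (+ 0) L) ⟩
      range (+ 0) L                               ∎
      where open ≡-Reasoning

open import Defs
open import Data.Nat using (ℕ; _≤_; _+_; _*_; _∸_)
open import Data.Integer using (+_; -_)
open import Data.Product using (_×_; Σ; _,_)
open import Data.List using (List; []; _∷_)
open import Data.List.Membership.Propositional using (_∈_)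
open import Relation.Binary.PropositionalEquality using (_≡_; refl; cong)
open import Data.Nat.Tactic.RingSolver using (solve-∀)

mainTheorem3 : (L : ℕ) → 1 ≤ L →
    (block L 1 ≡ zeroβ ∷ [])
    × (∀ k → 1 ≤ k →
        (∀ x → x ∈ block L (2 * k + 1) →
           Σ ℕ λ m → qq L (2 * k) ≤ m × m ≤ qq L (2 * k + 2) ∸ 1
                     × IsFrac L (scal (- (+ m)) βelt) x)
        × (∀ m → qq L (2 * k) ≤ m → m ≤ qq L (2 * k + 2) ∸ 1 →
           Σ Zβ λ x → x ∈ block L (2 * k + 1) × IsFrac L (scal (- (+ m)) βelt) x))
    × (∀ k → 1 ≤ k →
        (∀ x → x ∈ block L (2 * k) →
           Σ ℕ λ m → qq L (2 * k ∸ 1) + 1 ≤ m × m ≤ qq L (2 * k + 1)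
                     × IsFrac L (scal (+ m) βelt) x)
        × (∀ m → qq L (2 * k ∸ 1) + 1 ≤ m → m ≤ qq L (2 * k + 1) →
           Σ Zβ λ x → x ∈ block L (2 * k) × IsFrac L (scal (+ m) βelt) x))
mainTheorem3 (ℕ.suc ℓ) _ = refl , odd , even
  where
  open LSSequence ℓ using (L; BlockPos; BlockNeg; block-odd; block-even; block-two)
  reindex : (F : ℕ → ℕ → ℕ → Set) {b a c b′ a′ c′ : ℕ} →
            b ≡ b′ → a ≡ a′ → c ≡ c′ → F b a c → F b′ a′ c′
  reindex F refl refl refl p = p
  odd : ∀ k → 1 ≤ k → BlockNeg (2 * k + 1) (qq L (2 * k)) (qq L (2 * k + 2))
  odd (ℕ.suc j) _ = reindex (λ b a c → BlockNeg b (qq L a) (qq L c)) (e₁ j) (e₂ j) (e₃ j) (block-odd j)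
    where
    e₁ : ∀ j → 3 + (j + j) ≡ 2 * (1 + j) + 1
    e₁ = solve-∀
    e₂ : ∀ j → 2 + (j + j) ≡ 2 * (1 + j)
    e₂ = solve-∀
    e₃ : ∀ j → 4 + (j + j) ≡ 2 * (1 + j) + 2
    e₃ = solve-∀
  even : ∀ k → 1 ≤ k → BlockPos (2 * k) (qq L (2 * k ∸ 1)) (qq L (2 * k + 1))
  even 1 _ = block-two
  even (ℕ.suc (ℕ.suc j)) _ = reindex (λ b a c → BlockPos b (qq L a) (qq L c)) (e₁ j) (e₂ j) (e₃ j) (block-even j)
    where
    e₁ : ∀ j → 4 + (j + j) ≡ 2 * (2 + j)
    e₁ = solve-∀
    e₂ : ∀ j → 3 + (j + j) ≡ 2 * (2 + j) ∸ 1
    e₂ j = cong (_∸ 1) (e₁ j)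
    e₃ : ∀ j → 5 + (j + j) ≡ 2 * (2 + j) + 1
    e₃ = solve-∀
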